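{- Let $k \geq 2$ and $n \geq 1$ be integers with $(k,n) \neq (2,1)$. Let $G=(V,E)$ be an $n$-balanced $k$-partite graph. If $$|E(G)| \geq n^{2}\binom{k}{2}-(k-1)n+2,$$ then $G$ is Hamiltonian, i.e., $G$ contains a cycle passing through every vertex of $G$ exactly once.
   Context: All graphs are finite, simple and undirected. An $n$-balanced $k$-partite graph is a graph whose vertex set is partitioned into $k$ parts $V_1,\dots,V_k$ with $|V_i|=n$ for each $i$, such that no edge has both endpoints in the same part (edges between different parts may or may not be present). -}

module Defs where

open import Data.Nat using (ℕ; zero; suc; _+_; _*_; _<_; _≤_)
open import Data.Fin using (Fin; toℕ)
open import Data.Fin.Properties using (_≟_)
open import Data.Bool using (Bool; true; false; if_then_else_)
open import Data.List using (List; length; filter; concatMap; map)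
open import Data.List.Base using (allFin)
open import Data.Product using (_×_; _,_; Σ)
open import Data.Sum using (_⊎_)
open import Relation.Binary.PropositionalEquality using (_≡_)
open import Function.Definitions using (Injective)
open import Relation.Nullary.Decidable using (⌊_⌋)
open import Data.Nat.Properties using (_<?_)

record SimpleGraph (N : ℕ) : Set where
  field
    adj     : Fin N → Fin N → Bool
    symm    : ∀ u v → adj u v ≡ adj v u
    irrefl  : ∀ v → adj v v ≡ false
open SimpleGraph public

edgeCount : {N : ℕ} → SimpleGraph N → ℕ
edgeCount {N} G =
  length (filter (λ p → ⌊ toℕ (Data.Product.proj₁ p) <? toℕ (Data.Product.proj₂ p) ⌋ Data.Bool.∧ adj G (Data.Product.proj₁ p) (Data.Product.proj₂ p) Data.Bool.≟ true)
    (concatMap (λ u → map (λ v → (u , v)) (allFin N)) (allFin N)))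

partSize : {N k : ℕ} → (Fin N → Fin k) → Fin k → ℕ
partSize {N} part c = length (filter (λ v → part v ≟ c) (allFin N))

IsBalancedMultipartite : (k n : ℕ) → SimpleGraph (k * n) → (Fin (k * n) → Fin k) → Set
IsBalancedMultipartite k n G part =
  (∀ c → partSize part c ≡ n) ×
  (∀ u v → part u ≡ part v → adj G u v ≡ false)

-- A Hamiltonian cycle: a cycle (at least 3 vertices) visiting every vertex
-- exactly once, given as an injective (hence bijective) enumeration of the
-- vertices in which cyclically consecutive vertices are adjacent.
Hamiltonian : {N : ℕ} → SimpleGraph N → Set
Hamiltonian {N} G =
  (3 ≤ N) ×
  Σ (Fin N → Fin N) λ σ →
    Injective _≡_ _≡_ σ ×
    (∀ (i j : Fin N) →
       (suc (toℕ i) ≡ toℕ j ⊎ (suc (toℕ i) ≡ N × toℕ j ≡ 0)) →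
       adj G (σ i) (σ j) ≡ true)

-- Let D = (k - 1) n be the number of vertices outside a part, and let the deficit of a vertex be
-- the number of vertices outside its part that it is not adjacent to, so that deg a + deficit a = D.
-- As the degrees sum to 2|E| and 2 n² C(k,2) = k n D, the edge bound says exactly that the deficits
-- sum to at most 2D - 4. Double counting non-adjacent pairs then bounds the total deficit of any set
-- inside one part by D - 2, and the deficits of any two vertices by D - 1 together.
--
-- These bounds make the Bondy–Chvátal closure of G complete. Calling a vertex saturated when its
-- deficit is 0, we add the edges inside the parts between two saturated vertices, then between a
-- saturated and an unsaturated one, then between two unsaturated ones, and finally all remaining
-- pairs; each added pair satisfies Ore's condition deg u + deg v ≥ k n in the graph built so far.
-- The complete graph on k n ≥ 3 vertices is Hamiltonian, and Ore's crossing argument carries a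
-- Hamiltonian cycle back through each added edge to G.

module Submission where

open import Defs
open import Data.Bool using (Bool; true; false; _∧_; _∨_; not; _xor_)
open import Data.Bool.Properties using (∧-identityʳ; ∧-zeroʳ; ∨-identityʳ; ∧-comm; ∨-comm; ¬-not; ∨-conicalˡ)
import Data.Bool.Properties as Boolₚ
open import Data.Empty using (⊥; ⊥-elim)
open import Data.Fin using (Fin; toℕ; inject₁; fromℕ) renaming (zero to fzero; suc to fsuc)
import Data.Fin.Properties as Finₚ
open import Data.List using (List; []; _∷_; _++_; length; filter; map; concatMap; tabulate; allFin; cartesianProduct)
open import Data.List.Membership.Propositional using (_∈_)
open import Data.List.Membership.Propositional.Properties using (∈-cartesianProduct⁺; ∈-allFin)
open import Data.List.Relation.Unary.Any using (here; there)
open import Data.Nat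
  using (ℕ; zero; suc; _+_; _*_; _∸_; _^_; _≤_; _<_; _≥_; z≤n; s≤s; s≤s⁻¹; _≤?_; _<?_; _≡ᵇ_; anyUpTo?)
open import Data.Nat.Combinatorics using (_C_; nC1≡n; nCk+nC[k+1]≡[n+1]C[k+1])
open import Data.Nat.DivMod using (_mod_; m≤n⇒m%n≡m)
open import Data.Nat.Properties
open import Data.Nat.Tactic.RingSolver using (solve-∀)
open import Data.Product using (Σ; _×_; _,_; proj₁; proj₂)
open import Data.Sum using (_⊎_; inj₁; inj₂; map₂)
open import Function using (_∘_; case_of_)
open import Function.Bundles using (mk⇔)
open import Function.Definitions using (Injective)
open import Relation.Binary using (tri<; tri≈; tri>)
open import Relation.Binary.PropositionalEquality
open import Relation.Nullary using (¬_; does; yes; no; contradiction)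
open import Relation.Nullary.Decidable using (⌊_⌋; dec-true; dec-false; does-⇔; isYes≗does)
open import Relation.Unary using (Pred; Decidable)
open import Algebra.Properties.CommutativeMonoid.Sum +-0-commutativeMonoid
  using (sum; ∑-distrib-+; ∑-comm; sum-cong-≗; sum-replicate-zero; sum-init-last)

m+m≤n+n⇒m≤n : ∀ {m n} → m + m ≤ n + n → m ≤ n
m+m≤n+n⇒m≤n {m} {n} m+m≤n+n with ≤-<-connex m n
... | inj₁ m≤n = m≤n
... | inj₂ n<m = contradiction m+m≤n+n (<⇒≱ (+-mono-< n<m n<m))

-- Counting over Fin N

_==_ : ∀ {N} → Fin N → Fin N → Bool
a == b = does (a Finₚ.≟ b)

==-refl : ∀ {N} (a : Fin N) → (a == a) ≡ true
==-refl a = dec-true (a Finₚ.≟ a) refl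

==⇒≡ : ∀ {N} {a b : Fin N} → (a == b) ≡ true → a ≡ b
==⇒≡ {a = a} {b} a==b with a Finₚ.≟ b
... | yes a≡b = a≡b
... | no _ = contradiction a==b λ ()

≢⇒==-false : ∀ {N} {a b : Fin N} → a ≢ b → (a == b) ≡ false
≢⇒==-false {a = a} {b} = dec-false (a Finₚ.≟ b)

==-sym : ∀ {N} (a b : Fin N) → (a == b) ≡ (b == a)
==-sym a b = does-⇔ (mk⇔ sym sym) (a Finₚ.≟ b) (b Finₚ.≟ a)

∨-introˡ : ∀ {b} c → b ≡ true → (b ∨ c) ≡ true
∨-introˡ c refl = refl

∨-introʳ : ∀ b {c} → c ≡ true → (b ∨ c) ≡ true
∨-introʳ true  _    = refl
∨-introʳ false refl = refl

∨-elim : ∀ {b c} → (b ∨ c) ≡ true → b ≡ true ⊎ c ≡ true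
∨-elim {true}  _ = inj₁ refl
∨-elim {false} c = inj₂ c

∧-elim : ∀ {b c} → (b ∧ c) ≡ true → b ≡ true × c ≡ true
∧-elim {true} c = refl , c

not-true : ∀ {b} → not b ≡ true → b ≡ false
not-true {false} _ = refl

when : Bool → ℕ → ℕ
when true  x = x
when false _ = 0

when-≤ : ∀ b x → when b x ≤ x
when-≤ true  x = ≤-refl
when-≤ false x = z≤n

when-mono : ∀ {b c} x → (b ≡ true → c ≡ true) → when b x ≤ when c x
when-mono {false} x _ = z≤n
when-mono {true}  x b⇒c rewrite b⇒c refl = ≤-refl

when-∧ : ∀ b c x → when (b ∧ c) x ≡ when b (when c x)
when-∧ true  c x = refl
when-∧ false c x = refl

when-∧′ : ∀ b c x → when (b ∧ c) x ≡ when c (when b x)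
when-∧′ true  c     x = refl
when-∧′ false true  x = refl
when-∧′ false false x = refl

when-∨-∧ : ∀ b c x → when (b ∨ c) x + when (b ∧ c) x ≡ when b x + when c x
when-∨-∧ true  true  x = refl
when-∨-∧ true  false x = refl
when-∨-∧ false true  x = +-comm x 0
when-∨-∧ false false x = refl

when-split : ∀ b c x → when b x ≡ when (b ∧ c) x + when (b ∧ not c) x
when-split true  true  x = sym (+-identityʳ x)
when-split true  false x = refl
when-split false c     x = refl

when-not : ∀ b → when b 1 + when (not b) 1 ≡ 1
when-not true  = refl
when-not false = refl

sum-zero : ∀ N → sum {N} (λ _ → 0) ≡ 0
sum-zero N = sum-replicate-zero N

sum-const : ∀ N c → sum {N} (λ _ → c) ≡ N * c
sum-const zero    c = refl
sum-const (suc N) c = cong (c +_) (sum-const N c)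

sum-cong : ∀ {N} {f g : Fin N → ℕ} → (∀ i → f i ≡ g i) → sum f ≡ sum g
sum-cong = sum-cong-≗

sum-mono : ∀ {N} {f g : Fin N → ℕ} → (∀ i → f i ≤ g i) → sum f ≤ sum g
sum-mono {zero}  f≤g = z≤n
sum-mono {suc N} f≤g = +-mono-≤ (f≤g fzero) (sum-mono (λ i → f≤g (fsuc i)))

sum-when : ∀ {N} c (f : Fin N → ℕ) → sum (λ i → when c (f i)) ≡ when c (sum f)
sum-when true  f = refl
sum-when {N} false f = sum-zero N

sum-point : ∀ {N} (a : Fin N) (f : Fin N → ℕ) → sum (λ i → when (i == a) (f i)) ≡ f a
sum-point {suc N} fzero    f = begin
  f fzero + sum {N} (λ i → when (fsuc i == fzero) (f (fsuc i))) ≡⟨ cong (f fzero +_) (sum-zero N) ⟩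
  f fzero + 0                                                   ≡⟨ +-identityʳ _ ⟩
  f fzero ∎
  where open ≡-Reasoning
sum-point {suc N} (fsuc a) f = sum-point a (λ i → f (fsuc i))

sum-when-remove : ∀ {N} (S : Fin N → Bool) (f : Fin N → ℕ) (b : Fin N) →
  sum (λ a → when (S a) (f a)) ≡ when (S b) (f b) + sum (λ a → when (S a ∧ not (a == b)) (f a))
sum-when-remove S f b = begin
  sum (λ a → when (S a) (f a))
    ≡⟨ sum-cong (λ a → when-split (S a) (a == b) (f a)) ⟩
  sum (λ a → when (S a ∧ (a == b)) (f a) + when (S a ∧ not (a == b)) (f a))
    ≡⟨ ∑-distrib-+ (λ a → when (S a ∧ (a == b)) (f a)) _ ⟩
  sum (λ a → when (S a ∧ (a == b)) (f a)) + sum (λ a → when (S a ∧ not (a == b)) (f a))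
    ≡⟨ cong (_+ sum (λ a → when (S a ∧ not (a == b)) (f a)))
         (trans (sum-cong (λ a → when-∧′ (S a) (a == b) (f a))) (sum-point b (λ a → when (S a) (f a)))) ⟩
  when (S b) (f b) + sum (λ a → when (S a ∧ not (a == b)) (f a)) ∎
  where open ≡-Reasoning

sum-when-∨ : ∀ {N} (P Q : Fin N → Bool) (f : Fin N → ℕ) → (∀ i → (P i ∧ Q i) ≡ false) →
  sum (λ i → when (P i ∨ Q i) (f i)) ≡ sum (λ i → when (P i) (f i)) + sum (λ i → when (Q i) (f i))
sum-when-∨ {N} P Q f disjoint = begin
  sum (λ i → when (P i ∨ Q i) (f i))
    ≡⟨ sym (+-identityʳ _) ⟩
  sum (λ i → when (P i ∨ Q i) (f i)) + 0
    ≡⟨ cong (sum (λ i → when (P i ∨ Q i) (f i)) +_) (sym overlap≡0) ⟩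
  sum (λ i → when (P i ∨ Q i) (f i)) + sum (λ i → when (P i ∧ Q i) (f i))
    ≡⟨ sym (∑-distrib-+ (λ i → when (P i ∨ Q i) (f i)) (λ i → when (P i ∧ Q i) (f i))) ⟩
  sum (λ i → when (P i ∨ Q i) (f i) + when (P i ∧ Q i) (f i))
    ≡⟨ sum-cong (λ i → when-∨-∧ (P i) (Q i) (f i)) ⟩
  sum (λ i → when (P i) (f i) + when (Q i) (f i))
    ≡⟨ ∑-distrib-+ (λ i → when (P i) (f i)) (λ i → when (Q i) (f i)) ⟩
  sum (λ i → when (P i) (f i)) + sum (λ i → when (Q i) (f i)) ∎
  where
  open ≡-Reasoning
  overlap≡0 : sum (λ i → when (P i ∧ Q i) (f i)) ≡ 0
  overlap≡0 = trans (sum-cong (λ i → cong (λ b → when b (f i)) (disjoint i))) (sum-zero N)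

==-disjoint : ∀ {N} {u v : Fin N} → u ≢ v → ∀ b → ((b == u) ∧ (b == v)) ≡ false
==-disjoint {u = u} {v} u≢v b with b == u in b==u
... | false = refl
... | true  = ≢⇒==-false (λ b≡v → u≢v (trans (sym (==⇒≡ {a = b} b==u)) b≡v))

sum-pair : ∀ {N} {u v : Fin N} → u ≢ v → (f : Fin N → ℕ) →
  sum (λ b → when ((b == u) ∨ (b == v)) (f b)) ≡ f u + f v
sum-pair {u = u} {v} u≢v f =
  trans (sum-when-∨ (λ b → b == u) (λ b → b == v) f (==-disjoint u≢v)) (cong₂ _+_ (sum-point u f) (sum-point v f))

count : ∀ {N} → (Fin N → Bool) → ℕ
count P = sum (λ i → when (P i) 1)

count-cong : ∀ {N} {P Q : Fin N → Bool} → (∀ i → P i ≡ Q i) → count P ≡ count Q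
count-cong P≡Q = sum-cong (λ i → cong (λ b → when b 1) (P≡Q i))

count-mono : ∀ {N} {P Q : Fin N → Bool} → (∀ i → P i ≡ true → Q i ≡ true) → count P ≤ count Q
count-mono P⇒Q = sum-mono (λ i → when-mono 1 (P⇒Q i))

count-≤ : ∀ {N} (P : Fin N → Bool) → count P ≤ N
count-≤ {N} P = subst (count P ≤_) (trans (sum-const N 1) (*-identityʳ N)) (sum-mono (λ i → when-≤ (P i) 1))

count-compl : ∀ {N} (P : Fin N → Bool) → count P + count (λ i → not (P i)) ≡ N
count-compl {N} P = begin
  count P + count (λ i → not (P i))      ≡⟨ sym (∑-distrib-+ (λ i → when (P i) 1) (λ i → when (not (P i)) 1)) ⟩
  sum (λ i → when (P i) 1 + when (not (P i)) 1) ≡⟨ sum-cong (λ i → when-not (P i)) ⟩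
  sum {N} (λ _ → 1)                      ≡⟨ sum-const N 1 ⟩
  N * 1                                  ≡⟨ *-identityʳ N ⟩
  N ∎
  where open ≡-Reasoning

count-split : ∀ {N} (P Q : Fin N → Bool) → count P ≡ count (λ a → P a ∧ Q a) + count (λ a → P a ∧ not (Q a))
count-split P Q = trans (sum-cong (λ a → when-split (P a) (Q a) 1)) (∑-distrib-+ (λ a → when (P a ∧ Q a) 1) _)

count-≤-sum : ∀ {N} (S : Fin N → Bool) (f : Fin N → ℕ) → (∀ a → S a ≡ true → 1 ≤ f a) →
  count S ≤ sum (λ a → when (S a) (f a))
count-≤-sum S f pos = sum-mono (λ a → bound (S a) (pos a))
  where
  bound : ∀ {y} s → (s ≡ true → 1 ≤ y) → when s 1 ≤ when s y
  bound true  pos = pos refl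
  bound false pos = z≤n

count-witness : ∀ {N} (P : Fin N → Bool) → 0 < count P → Σ (Fin N) λ i → P i ≡ true
count-witness {suc N} P pos with P fzero in P0
... | true  = fzero , P0
... | false = let (i , Pi) = count-witness (λ i → P (fsuc i)) pos in fsuc i , Pi

count-∧-witness : ∀ {N} (P Q : Fin N → Bool) → N < count P + count Q → Σ (Fin N) λ i → P i ≡ true × Q i ≡ true
count-∧-witness {N} P Q N<P+Q =
  let (i , PQi) = count-witness (λ i → P i ∧ Q i) common-positive in i , ∧-elim {P i} PQi
  where
  inclusion-exclusion : count (λ i → P i ∨ Q i) + count (λ i → P i ∧ Q i) ≡ count P + count Q
  inclusion-exclusion = trans (sym (∑-distrib-+ (λ i → when (P i ∨ Q i) 1) _))
    (trans (sum-cong (λ i → when-∨-∧ (P i) (Q i) 1)) (∑-distrib-+ (λ i → when (P i) 1) _))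
  common-positive : 0 < count (λ i → P i ∧ Q i)
  common-positive = +-cancelˡ-< N 0 _ (begin-strict
    N + 0                                             ≡⟨ +-identityʳ N ⟩
    N                                                 <⟨ N<P+Q ⟩
    count P + count Q                                 ≡⟨ sym inclusion-exclusion ⟩
    count (λ i → P i ∨ Q i) + count (λ i → P i ∧ Q i) ≤⟨ +-monoˡ-≤ _ (count-≤ (λ i → P i ∨ Q i)) ⟩
    N + count (λ i → P i ∧ Q i)                       ∎)
    where open ≤-Reasoning

count-∘-injective : ∀ {n N} (g : Fin n → Fin N) → Injective _≡_ _≡_ g → (Q : Fin N → Bool) →
  count (λ i → Q (g i)) ≤ count Q
count-∘-injective {zero}  g g-inj Q = z≤n
count-∘-injective {suc n} {N} g g-inj Q = begin
  when (Q g₀) 1 + count (λ i → Q (g (fsuc i)))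
    ≡⟨ cong (when (Q g₀) 1 +_) (count-cong Q′∘g∘suc) ⟨
  when (Q g₀) 1 + count (λ i → Q′ (g (fsuc i)))
    ≤⟨ +-monoʳ-≤ (when (Q g₀) 1) (count-∘-injective (λ i → g (fsuc i)) (λ e → Finₚ.suc-injective (g-inj e)) Q′) ⟩
  when (Q g₀) 1 + count Q′
    ≡⟨ sum-when-remove Q (λ _ → 1) g₀ ⟨
  count Q ∎
  where
  open ≤-Reasoning
  g₀ : Fin N
  g₀ = g fzero
  Q′ : Fin N → Bool
  Q′ a = Q a ∧ not (a == g₀)
  Q′∘g∘suc : ∀ i → Q′ (g (fsuc i)) ≡ Q (g (fsuc i))
  Q′∘g∘suc i = trans (cong (λ b → Q (g (fsuc i)) ∧ not b) (≢⇒==-false (λ e → Finₚ.0≢1+n (sym (g-inj e)))))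
                     (∧-identityʳ _)

count-∘-injective-≡ : ∀ {N} (g : Fin N → Fin N) → Injective _≡_ _≡_ g → (Q : Fin N → Bool) →
  count (λ i → Q (g i)) ≡ count Q
count-∘-injective-≡ {N} g g-inj Q = ≤-antisym (count-∘-injective g g-inj Q) (+-cancelʳ-≤ _ _ _ (begin
  count Q + count (λ i → not (Q (g i)))        ≤⟨ +-monoʳ-≤ (count Q) (count-∘-injective g g-inj (λ a → not (Q a))) ⟩
  count Q + count (λ a → not (Q a))            ≡⟨ count-compl Q ⟩
  N                                            ≡⟨ count-compl (λ i → Q (g i)) ⟨
  count (λ i → Q (g i)) + count (λ i → not (Q (g i))) ∎))
  where open ≤-Reasoning

deg : ∀ {N} → SimpleGraph N → Fin N → ℕ
deg G v = count (adj G v)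

_⊆ᴳ_ : ∀ {N} → SimpleGraph N → SimpleGraph N → Set
G ⊆ᴳ H = ∀ a b → adj G a b ≡ true → adj H a b ≡ true

deg-mono : ∀ {N} {G H : SimpleGraph N} → G ⊆ᴳ H → ∀ v → deg G v ≤ deg H v
deg-mono G⊆H v = count-mono (G⊆H v)

_∪ᴳ_ : ∀ {N} → SimpleGraph N → SimpleGraph N → SimpleGraph N
G ∪ᴳ H = record
  { adj    = λ a b → adj G a b ∨ adj H a b
  ; symm   = λ a b → cong₂ _∨_ (symm G a b) (symm H a b)
  ; irrefl = λ a → cong₂ _∨_ (irrefl G a) (irrefl H a)
  }

⊆-∪ˡ : ∀ {N} (G H : SimpleGraph N) → G ⊆ᴳ (G ∪ᴳ H)
⊆-∪ˡ G H a b = ∨-introˡ (adj H a b)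

⊆-∪ʳ : ∀ {N} (G H : SimpleGraph N) → H ⊆ᴳ (G ∪ᴳ H)
⊆-∪ʳ G H a b = ∨-introʳ (adj G a b)

deg-∪ˡ : ∀ {N} (G H : SimpleGraph N) v → deg G v ≤ deg (G ∪ᴳ H) v
deg-∪ˡ G H = deg-mono {G = G} {G ∪ᴳ H} (⊆-∪ˡ G H)

complete : ∀ {N} → SimpleGraph N
complete = record
  { adj    = λ a b → not (a == b)
  ; symm   = λ a b → cong not (==-sym a b)
  ; irrefl = λ a → cong not (==-refl a)
  }

distinct⇒injective : ∀ {A : Set} {M} (f : ℕ → A) → (∀ i j → i < j → j ≤ M → f i ≢ f j) →
  ∀ {i j} → i ≤ M → j ≤ M → f i ≡ f j → i ≡ j
distinct⇒injective f distinct {i} {j} i≤M j≤M fi≡fj with <-cmp i j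
... | tri< i<j _ _ = contradiction fi≡fj (distinct i j i<j j≤M)
... | tri≈ _ i≡j _ = i≡j
... | tri> _ _ j<i = contradiction (sym fi≡fj) (distinct j i j<i i≤M)

-- Edge count and the handshake lemma

countᴸ : ∀ {A : Set} → (A → Bool) → List A → ℕ
countᴸ f []       = 0
countᴸ f (x ∷ xs) = when (f x) 1 + countᴸ f xs

length-filter≡countᴸ : ∀ {A : Set} {ℓ} {P : Pred A ℓ} (P? : Decidable P) xs →
  length (filter P? xs) ≡ countᴸ (λ x → does (P? x)) xs
length-filter≡countᴸ P? []       = refl
length-filter≡countᴸ P? (x ∷ xs) with does (P? x)
... | true  = cong suc (length-filter≡countᴸ P? xs)
... | false = length-filter≡countᴸ P? xs

countᴸ-cong : ∀ {A : Set} {f g : A → Bool} → (∀ x → f x ≡ g x) → ∀ xs → countᴸ f xs ≡ countᴸ g xs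
countᴸ-cong f≗g []       = refl
countᴸ-cong f≗g (x ∷ xs) = cong₂ (λ b c → when b 1 + c) (f≗g x) (countᴸ-cong f≗g xs)

countᴸ-++ : ∀ {A : Set} (f : A → Bool) xs ys → countᴸ f (xs ++ ys) ≡ countᴸ f xs + countᴸ f ys
countᴸ-++ f []       ys = refl
countᴸ-++ f (x ∷ xs) ys = trans (cong (when (f x) 1 +_) (countᴸ-++ f xs ys)) (sym (+-assoc (when (f x) 1) _ _))

countᴸ-map : ∀ {A B : Set} (f : B → Bool) (g : A → B) xs → countᴸ f (map g xs) ≡ countᴸ (λ x → f (g x)) xs
countᴸ-map f g []       = refl
countᴸ-map f g (x ∷ xs) = cong (when (f (g x)) 1 +_) (countᴸ-map f g xs)

countᴸ-tabulate : ∀ {A : Set} {N} (f : A → Bool) (g : Fin N → A) → countᴸ f (tabulate g) ≡ count (λ i → f (g i))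
countᴸ-tabulate {N = zero}  f g = refl
countᴸ-tabulate {N = suc N} f g = cong (when (f (g fzero)) 1 +_) (countᴸ-tabulate f (λ i → g (fsuc i)))

countᴸ-concatMap-tabulate : ∀ {A B : Set} {N} (f : B → Bool) (g : A → List B) (h : Fin N → A) →
  countᴸ f (concatMap g (tabulate h)) ≡ sum (λ i → countᴸ f (g (h i)))
countᴸ-concatMap-tabulate {N = zero}  f g h = refl
countᴸ-concatMap-tabulate {N = suc N} f g h =
  trans (countᴸ-++ f (g (h fzero)) (concatMap g (tabulate (λ i → h (fsuc i)))))
        (cong (countᴸ f (g (h fzero)) +_) (countᴸ-concatMap-tabulate f g (λ i → h (fsuc i))))

_<ᶠ_ : ∀ {N} → Fin N → Fin N → Bool
u <ᶠ v = ⌊ toℕ u <? toℕ v ⌋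

forwardEdges : ∀ {N} → SimpleGraph N → ℕ
forwardEdges G = sum (λ u → count (λ v → (u <ᶠ v) ∧ adj G u v))

edgeCount≡forwardEdges : ∀ {N} (G : SimpleGraph N) → edgeCount G ≡ forwardEdges G
edgeCount≡forwardEdges {N} G = begin
  edgeCount G
    ≡⟨ length-filter≡countᴸ (λ p → f p Boolₚ.≟ true) pairs ⟩
  countᴸ (λ p → does (f p Boolₚ.≟ true)) pairs
    ≡⟨ countᴸ-cong (λ p → does-≟-true (f p)) pairs ⟩
  countᴸ f pairs
    ≡⟨ countᴸ-concatMap-tabulate f (λ u → map (λ v → (u , v)) (allFin N)) (λ u → u) ⟩
  sum (λ u → countᴸ f (map (λ v → (u , v)) (allFin N)))
    ≡⟨ sum-cong (λ u → trans (countᴸ-map f (λ v → (u , v)) (allFin N))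
                             (countᴸ-tabulate (λ v → f (u , v)) (λ v → v))) ⟩
  forwardEdges G ∎
  where
  open ≡-Reasoning
  f : Fin N × Fin N → Bool
  f p = (proj₁ p <ᶠ proj₂ p) ∧ adj G (proj₁ p) (proj₂ p)
  pairs : List (Fin N × Fin N)
  pairs = concatMap (λ u → map (λ v → (u , v)) (allFin N)) (allFin N)
  does-≟-true : ∀ b → does (b Boolₚ.≟ true) ≡ b
  does-≟-true true  = refl
  does-≟-true false = refl

⌊⌋-true : ∀ {m n} → m < n → ⌊ m <? n ⌋ ≡ true
⌊⌋-true {m} {n} m<n = trans (isYes≗does (m <? n)) (dec-true (m <? n) m<n)

⌊⌋-false : ∀ {m n} → ¬ m < n → ⌊ m <? n ⌋ ≡ false
⌊⌋-false {m} {n} m≮n = trans (isYes≗does (m <? n)) (dec-false (m <? n) m≮n)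

<ᶠ-exclusive : ∀ {N} {u v : Fin N} → u ≢ v → when (u <ᶠ v) 1 + when (v <ᶠ u) 1 ≡ 1
<ᶠ-exclusive {u = u} {v} u≢v with <-cmp (toℕ u) (toℕ v)
... | tri< u<v _ _ = cong₂ (λ b c → when b 1 + when c 1) (⌊⌋-true u<v) (⌊⌋-false (<-asym u<v))
... | tri≈ _ u≡v _ = contradiction (Finₚ.toℕ-injective u≡v) u≢v
... | tri> _ _ v<u = cong₂ (λ b c → when b 1 + when c 1) (⌊⌋-false (<-asym v<u)) (⌊⌋-true v<u)

adj-by-order : ∀ {N} (G : SimpleGraph N) u v →
  when (adj G u v) 1 ≡ when ((u <ᶠ v) ∧ adj G u v) 1 + when ((v <ᶠ u) ∧ adj G v u) 1
adj-by-order G u v with adj G u v in u~v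
... | false rewrite trans (symm G v u) u~v | ∧-zeroʳ (u <ᶠ v) | ∧-zeroʳ (v <ᶠ u) = refl
... | true  rewrite trans (symm G v u) u~v | ∧-identityʳ (u <ᶠ v) | ∧-identityʳ (v <ᶠ u) =
  sym (<ᶠ-exclusive {u = u} {v} (λ { refl → contradiction (trans (sym u~v) (irrefl G u)) λ () }))

handshake : ∀ {N} (G : SimpleGraph N) → sum (deg G) ≡ edgeCount G + edgeCount G
handshake G = begin
  sum (deg G)
    ≡⟨ sum-cong (λ u → trans (sum-cong (adj-by-order G u)) (∑-distrib-+ (λ v → when ((u <ᶠ v) ∧ adj G u v) 1) _)) ⟩
  sum (λ u → count (λ v → (u <ᶠ v) ∧ adj G u v) + sum (λ v → when ((v <ᶠ u) ∧ adj G v u) 1))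
    ≡⟨ ∑-distrib-+ (λ u → count (λ v → (u <ᶠ v) ∧ adj G u v)) _ ⟩
  forwardEdges G + sum (λ u → sum (λ v → when ((v <ᶠ u) ∧ adj G v u) 1))
    ≡⟨ cong (forwardEdges G +_) (∑-comm (λ u v → when ((v <ᶠ u) ∧ adj G v u) 1)) ⟩
  forwardEdges G + forwardEdges G
    ≡⟨ cong₂ _+_ (edgeCount≡forwardEdges G) (edgeCount≡forwardEdges G) ⟨
  edgeCount G + edgeCount G ∎
  where open ≡-Reasoning

-- Hamiltonian paths and cycles, Ore's lemma and the Bondy–Chvátal closure

-- The vertices of the path are vertex 0, …, vertex M; values at larger indices are irrelevant.
record HamPath {M} (G : SimpleGraph (suc M)) : Set where
  field
    vertex   : ℕ → Fin (suc M)
    distinct : ∀ i j → i < j → j ≤ M → vertex i ≢ vertex j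
    step     : ∀ i → i < M → adj G (vertex i) (vertex (suc i)) ≡ true

  injective : ∀ {i j} → i ≤ M → j ≤ M → vertex i ≡ vertex j → i ≡ j
  injective = distinct⇒injective vertex distinct

  vertexAt : Fin (suc M) → Fin (suc M)
  vertexAt i = vertex (toℕ i)

  vertexAt-injective : Injective _≡_ _≡_ vertexAt
  vertexAt-injective {i} {j} e = Finₚ.toℕ-injective (injective (s≤s⁻¹ (Finₚ.toℕ<n i)) (s≤s⁻¹ (Finₚ.toℕ<n j)) e)

  first last : Fin (suc M)
  first = vertex 0
  last  = vertex M

record HamCycle {M} (G : SimpleGraph (suc M)) : Set where
  field
    path  : HamPath G
  open HamPath path public
  field
    close : adj G last first ≡ true

hamCycle-mono : ∀ {M} {G H : SimpleGraph (suc M)} → G ⊆ᴳ H → HamCycle G → HamCycle H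
hamCycle-mono G⊆H cyc = record
  { path  = record { vertex = vertex ; distinct = distinct ; step = λ i i<M → G⊆H _ _ (step i i<M) }
  ; close = G⊆H _ _ close
  }
  where open HamCycle cyc

complete-hamCycle : ∀ {M} → 1 ≤ M → HamCycle (complete {suc M})
complete-hamCycle {M} 1≤M = record
  { path  = record
    { vertex   = vertex
    ; distinct = λ i j i<j j≤M → vertex-distinct (≤-trans (<⇒≤ i<j) j≤M) j≤M (<⇒≢ i<j)
    ; step     = λ i i<M → cong not (≢⇒==-false (vertex-distinct (<⇒≤ i<M) i<M (<⇒≢ (n<1+n i))))
    }
  ; close = cong not (≢⇒==-false (vertex-distinct ≤-refl z≤n (λ M≡0 → <⇒≢ 1≤M (sym M≡0))))
  }
  where
  vertex : ℕ → Fin (suc M)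
  vertex t = t mod suc M
  toℕ-vertex : ∀ {t} → t ≤ M → toℕ (vertex t) ≡ t
  toℕ-vertex t≤M = trans (Finₚ.toℕ-fromℕ< _) (m≤n⇒m%n≡m t≤M)
  vertex-distinct : ∀ {i j} → i ≤ M → j ≤ M → i ≢ j → vertex i ≢ vertex j
  vertex-distinct i≤M j≤M i≢j vi≡vj = i≢j (trans (sym (toℕ-vertex i≤M)) (trans (cong toℕ vi≡vj) (toℕ-vertex j≤M)))

module _ {M} {G : SimpleGraph (suc M)} (P : HamPath G) where
  open HamPath P

  deg-along : ∀ v → deg G v ≡ count (λ i → adj G v (vertexAt i))
  deg-along v = sym (count-∘-injective-≡ vertexAt vertexAt-injective (adj G v))

  deg-first : deg G first ≡ count {M} (λ i → adj G first (vertex (suc (toℕ i))))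
  deg-first = trans (deg-along first)
    (cong (λ b → when b 1 + count {M} (λ i → adj G first (vertex (suc (toℕ i))))) (irrefl G first))

  deg-last : deg G last ≡ count {M} (λ i → adj G (vertex (toℕ i)) last)
  deg-last = begin
    deg G last
      ≡⟨ deg-along last ⟩
    count (λ i → adj G last (vertexAt i))
      ≡⟨ sum-init-last (λ i → when (adj G last (vertexAt i)) 1) ⟩
    count {M} (λ i → adj G last (vertex (toℕ (inject₁ i)))) + when (adj G last (vertex (toℕ (fromℕ M)))) 1
      ≡⟨ cong₂ _+_ (count-cong {M} (λ i → trans (cong (λ t → adj G last (vertex t)) (Finₚ.toℕ-inject₁ i))
                                               (symm G last (vertex (toℕ i)))))
                   (trans (cong (λ t → when (adj G last (vertex t)) 1) (Finₚ.toℕ-fromℕ M))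
                          (cong (λ b → when b 1) (irrefl G last))) ⟩
    count {M} (λ i → adj G (vertex (toℕ i)) last) + 0
      ≡⟨ +-identityʳ _ ⟩
    count {M} (λ i → adj G (vertex (toℕ i)) last) ∎
    where open ≡-Reasoning

  module Crossing (i : ℕ) (i<M : i < M)
    (first~ : adj G first (vertex (suc i)) ≡ true) (~last : adj G (vertex i) last ≡ true) where

    -- vertex 0, …, vertex i, then vertex M, vertex (M - 1), …, vertex (suc i)
    ι : ℕ → ℕ
    ι t with t ≤? i
    ... | yes _ = t
    ... | no  _ = suc M + i ∸ t

    ι-≤ : ∀ {t} → t ≤ i → ι t ≡ t
    ι-≤ {t} t≤i with t ≤? i
    ... | yes _  = refl
    ... | no t≰i = contradiction t≤i t≰i

    ι-> : ∀ {t} → i < t → ι t ≡ suc M + i ∸ t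
    ι-> {t} i<t with t ≤? i
    ... | yes t≤i = contradiction t≤i (<⇒≱ i<t)
    ... | no _    = refl

    1+M+i≡M+1+i : suc M + i ≡ M + suc i
    1+M+i≡M+1+i = sym (+-suc M i)

    reflected-≤ : ∀ {t} → i < t → suc M + i ∸ t ≤ M
    reflected-≤ {t} i<t = ≤-trans (∸-monoʳ-≤ (suc M + i) i<t)
      (≤-reflexive (trans (cong (_∸ suc i) 1+M+i≡M+1+i) (m+n∸n≡m M (suc i))))

    reflected-> : ∀ {t} → t ≤ M → i < suc M + i ∸ t
    reflected-> {t} t≤M = ≤-trans (≤-reflexive (sym (trans (cong (_∸ M) 1+M+i≡M+1+i) (m+n∸m≡n M (suc i)))))
      (∸-monoʳ-≤ (suc M + i) t≤M)

    ι-bounded : ∀ {t} → t ≤ M → ι t ≤ M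
    ι-bounded {t} t≤M with t ≤? i
    ... | yes _  = t≤M
    ... | no t≰i = reflected-≤ (≰⇒> t≰i)

    ι-distinct : ∀ a b → a < b → b ≤ M → ι a ≢ ι b
    ι-distinct a b a<b b≤M ιa≡ιb with ≤-<-connex b i | ≤-<-connex a i
    ... | inj₁ b≤i | _ =
      <-irrefl (trans (sym (ι-≤ (≤-trans (<⇒≤ a<b) b≤i))) (trans ιa≡ιb (ι-≤ b≤i))) a<b
    ... | inj₂ i<b | inj₁ a≤i =
      <⇒≱ (s≤s a≤i) (subst (suc i ≤_) (trans (sym (ι-> i<b)) (trans (sym ιa≡ιb) (ι-≤ a≤i))) (reflected-> b≤M))
    ... | inj₂ i<b | inj₂ i<a =
      <-irrefl (∸-cancelˡ-≡ (≤-trans (<⇒≤ a<b) b≤1+M+i) b≤1+M+i (trans (sym (ι-> i<a)) (trans ιa≡ιb (ι-> i<b)))) a<b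
      where
      b≤1+M+i : b ≤ suc M + i
      b≤1+M+i = ≤-trans b≤M (≤-trans (n≤1+n M) (m≤m+n (suc M) i))

    ι-1+i : ι (suc i) ≡ M
    ι-1+i = trans (ι-> ≤-refl) (trans (cong (_∸ suc i) 1+M+i≡M+1+i) (m+n∸n≡m M (suc i)))

    ι-M : ι M ≡ suc i
    ι-M = trans (ι-> i<M) (trans (cong (_∸ M) 1+M+i≡M+1+i) (m+n∸m≡n M (suc i)))

    ι-step : ∀ t → t < M → adj G (vertex (ι t)) (vertex (ι (suc t))) ≡ true
    ι-step t t<M with ≤-<-connex (suc t) i | ≤-<-connex t i
    ... | inj₁ 1+t≤i | _ =
      trans (cong₂ (λ a b → adj G (vertex a) (vertex b)) (ι-≤ (≤-trans (n≤1+n t) 1+t≤i)) (ι-≤ 1+t≤i)) (step t t<M)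
    ... | inj₂ i<1+t | inj₂ i<t =
      let j = suc M + i ∸ suc t
          ι-t : ι t ≡ suc j
          ι-t = trans (ι-> i<t) (+-∸-assoc-suc t<M)
          j<M : j < M
          j<M = subst (_≤ M) ι-t (ι-bounded (<⇒≤ t<M))
      in trans (cong₂ (λ a b → adj G (vertex a) (vertex b)) ι-t (ι-> i<1+t))
               (trans (symm G (vertex (suc j)) (vertex j)) (step j j<M))
      where
      +-∸-assoc-suc : t < M → suc M + i ∸ t ≡ suc (suc M + i ∸ suc t)
      +-∸-assoc-suc t<M = +-∸-assoc 1 (≤-trans t<M (≤-trans (n≤1+n M) (m≤m+n (suc M) i)))
    ... | inj₂ i<1+t | inj₁ t≤i with ≤-antisym t≤i (s≤s⁻¹ i<1+t)
    ...   | refl = subst₂ (λ a b → adj G (vertex a) (vertex b) ≡ true) (sym (ι-≤ ≤-refl)) (sym ι-1+i) ~last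

    cycle : HamCycle G
    cycle = record
      { path  = record
        { vertex   = λ t → vertex (ι t)
        ; distinct = λ a b a<b b≤M e → ι-distinct a b a<b b≤M
                       (injective (ι-bounded (≤-trans (<⇒≤ a<b) b≤M)) (ι-bounded b≤M) e)
        ; step     = ι-step
        }
      ; close = trans (cong₂ (λ a b → adj G (vertex a) (vertex b)) ι-M (ι-≤ z≤n))
                      (trans (symm G (vertex (suc i)) first) first~)
      }

  ore : suc M ≤ deg G first + deg G last → HamCycle G
  ore ore-condition =
    let (i , first~ , ~last) = count-∧-witness {M} _ _ (subst (suc M ≤_) (cong₂ _+_ deg-first deg-last) ore-condition)
    in Crossing.cycle (toℕ i) (Finₚ.toℕ<n i) first~ ~last

module Rotation {M} {G : SimpleGraph (suc M)} (cyc : HamCycle G) (r : ℕ) (r<M : r < M) where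
  open HamCycle cyc

  -- start the cycle at vertex (suc r), so that it closes with the edge from vertex r
  ρ : ℕ → ℕ
  ρ t with suc r + t ≤? M
  ... | yes _ = suc r + t
  ... | no  _ = suc r + t ∸ suc M

  ρ-≤ : ∀ {t} → suc r + t ≤ M → ρ t ≡ suc r + t
  ρ-≤ {t} h with suc r + t ≤? M
  ... | yes _ = refl
  ... | no ≰  = contradiction h ≰

  ρ-> : ∀ {t} → M < suc r + t → ρ t ≡ suc r + t ∸ suc M
  ρ-> {t} g with suc r + t ≤? M
  ... | yes h = contradiction h (<⇒≱ g)
  ... | no _  = refl

  wrapped-≤ : ∀ {t} → t ≤ M → suc r + t ∸ suc M ≤ r
  wrapped-≤ {t} t≤M = ≤-trans (∸-monoˡ-≤ M (+-monoʳ-≤ r t≤M)) (≤-reflexive (m+n∸n≡m r M))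

  ρ-bounded : ∀ {t} → t ≤ M → ρ t ≤ M
  ρ-bounded {t} t≤M with suc r + t ≤? M
  ... | yes h = h
  ... | no _  = ≤-trans (wrapped-≤ t≤M) (<⇒≤ r<M)

  ρ-distinct : ∀ a b → a < b → b ≤ M → ρ a ≢ ρ b
  ρ-distinct a b a<b b≤M ρa≡ρb with ≤-<-connex (suc r + b) M | ≤-<-connex (suc r + a) M
  ... | inj₁ hb | _ =
    <-irrefl (+-cancelˡ-≡ (suc r) a b
      (trans (sym (ρ-≤ (≤-trans (+-monoʳ-≤ (suc r) (<⇒≤ a<b)) hb))) (trans ρa≡ρb (ρ-≤ hb)))) a<b
  ... | inj₂ gb | inj₁ ha =
    <⇒≱ (s≤s ≤-refl) (≤-trans (m≤m+n (suc r) a)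
      (subst (_≤ r) (trans (sym (ρ-> gb)) (trans (sym ρa≡ρb) (ρ-≤ ha))) (wrapped-≤ b≤M)))
  ... | inj₂ gb | inj₂ ga =
    <-irrefl (+-cancelˡ-≡ r a b (∸-cancelʳ (s≤s⁻¹ ga) (s≤s⁻¹ gb) (trans (sym (ρ-> ga)) (trans ρa≡ρb (ρ-> gb))))) a<b
    where
    ∸-cancelʳ : ∀ {x y} → M ≤ x → M ≤ y → x ∸ M ≡ y ∸ M → x ≡ y
    ∸-cancelʳ M≤x M≤y e = trans (sym (m∸n+n≡m M≤x)) (trans (cong (_+ M) e) (m∸n+n≡m M≤y))

  ρ-M : ρ M ≡ r
  ρ-M = trans (ρ-> (s≤s (m≤n+m M r))) (m+n∸n≡m r M)

  ρ-0 : ρ 0 ≡ suc r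
  ρ-0 = trans (ρ-≤ (subst (_≤ M) (sym (+-identityʳ (suc r))) r<M)) (+-identityʳ (suc r))

  ρ-step : ∀ t → t < M → adj G (vertex (ρ t)) (vertex (ρ (suc t))) ≡ true
  ρ-step t t<M with ≤-<-connex (suc r + suc t) M | ≤-<-connex (suc r + t) M
  ... | inj₁ h | _ =
    let h′ = subst (_≤ M) (+-suc (suc r) t) h in
    trans (cong₂ (λ a b → adj G (vertex a) (vertex b)) (ρ-≤ (≤-trans (n≤1+n _) h′)) (trans (ρ-≤ h) (+-suc (suc r) t)))
          (step (suc r + t) h′)
  ... | inj₂ g | inj₁ h =
    let 1+r+t≡M = ≤-antisym h (s≤s⁻¹ (subst (M <_) (+-suc (suc r) t) g)) in
    trans (cong₂ (λ a b → adj G (vertex a) (vertex b))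
                 (trans (ρ-≤ h) 1+r+t≡M)
                 (trans (ρ-> g) (trans (cong (_∸ suc M) (+-suc (suc r) t)) (trans (cong (_∸ M) 1+r+t≡M) (n∸n≡0 M)))))
          close
  ... | inj₂ g | inj₂ g′ =
    let M≤r+t = s≤s⁻¹ g′
        j = suc r + t ∸ suc M
        ρ-1+t : ρ (suc t) ≡ suc j
        ρ-1+t = trans (ρ-> g) (trans (cong (_∸ suc M) (+-suc (suc r) t)) (+-∸-assoc 1 M≤r+t))
        j<M : j < M
        j<M = +-cancelʳ-< M j M (subst (_< M + M) (sym (m∸n+n≡m M≤r+t)) (+-mono-< r<M t<M))
    in trans (cong₂ (λ a b → adj G (vertex a) (vertex b)) (ρ-> g′) ρ-1+t) (step j j<M)

  rotated : HamCycle G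
  rotated = record
    { path  = record
      { vertex   = λ t → vertex (ρ t)
      ; distinct = λ a b a<b b≤M e → ρ-distinct a b a<b b≤M
                     (injective (ρ-bounded (≤-trans (<⇒≤ a<b) b≤M)) (ρ-bounded b≤M) e)
      ; step     = ρ-step
      }
    ; close = trans (cong₂ (λ a b → adj G (vertex a) (vertex b)) ρ-M ρ-0) (step r r<M)
    }

  rotated-last : HamCycle.last rotated ≡ vertex r
  rotated-last = cong vertex ρ-M

  rotated-first : HamCycle.first rotated ≡ vertex (suc r)
  rotated-first = cong vertex ρ-0

sameEdge : ∀ {N} → Fin N → Fin N → Fin N → Fin N → Bool
sameEdge u v a b = ((a == u) ∧ (b == v)) ∨ ((a == v) ∧ (b == u))

sameEdge-sound : ∀ {N} {u v a b : Fin N} → sameEdge u v a b ≡ true → (a ≡ u × b ≡ v) ⊎ (a ≡ v × b ≡ u)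
sameEdge-sound {u = u} {v} {a} {b} same with ∨-elim {(a == u) ∧ (b == v)} same
... | inj₁ a=u∧b=v = let (a=u , b=v) = ∧-elim {a == u} a=u∧b=v in inj₁ (==⇒≡ {a = a} a=u , ==⇒≡ {a = b} b=v)
... | inj₂ a=v∧b=u = let (a=v , b=u) = ∧-elim {a == v} a=v∧b=u in inj₂ (==⇒≡ {a = a} a=v , ==⇒≡ {a = b} b=u)

sameEdge-sym : ∀ {N} (u v a b : Fin N) → sameEdge u v a b ≡ sameEdge u v b a
sameEdge-sym u v a b = trans (∨-comm ((a == u) ∧ (b == v)) _) (cong₂ _∨_ (∧-comm (a == v) _) (∧-comm (a == u) _))

sameEdge-refl : ∀ {N} (u v : Fin N) → sameEdge u v u v ≡ true
sameEdge-refl u v rewrite ==-refl u | ==-refl v = refl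

sameEdge-transport : ∀ {N} (R : Fin N → Fin N → Bool) → (∀ x y → R x y ≡ R y x) →
  ∀ {u v a b} → sameEdge u v a b ≡ true → R a b ≡ R u v
sameEdge-transport R R-sym {u} {v} {a} {b} same with sameEdge-sound {u = u} {v} {a} {b} same
... | inj₁ (refl , refl) = refl
... | inj₂ (refl , refl) = R-sym _ _

module _ {M} {H H′ : SimpleGraph (suc M)} (2≤M : 2 ≤ M) {u v : Fin (suc M)}
  (H′⊆H+uv : ∀ a b → adj H′ a b ≡ true → adj H a b ≡ true ⊎ sameEdge u v a b ≡ true)
  (ore-uv : adj H u v ≡ false → suc M ≤ deg H u + deg H v) where

  private
    closing-through-uv : (cyc : HamCycle H′) → adj H (HamCycle.last cyc) (HamCycle.first cyc) ≡ false → HamCycle H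
    closing-through-uv cyc last≁first = ore path-in-H (subst (suc M ≤_) endpoint-degrees (ore-uv u≁v))
      where
      open HamCycle cyc
      closing-uv : sameEdge u v last first ≡ true
      closing-uv with H′⊆H+uv last first close
      ... | inj₁ last~first = contradiction (trans (sym last~first) last≁first) (λ ())
      ... | inj₂ same       = same
      u≁v : adj H u v ≡ false
      u≁v = trans (sym (sameEdge-transport (adj H) (symm H) closing-uv)) last≁first
      endpoint-degrees : deg H u + deg H v ≡ deg H first + deg H last
      endpoint-degrees with sameEdge-sound {u = u} {v} {last} {first} closing-uv
      ... | inj₁ (refl , refl) = +-comm (deg H last) (deg H first)
      ... | inj₂ (refl , refl) = refl
      -- a step of the cycle equal to the closing edge would force M = 1
      step-∉-closing : ∀ t → t < M → sameEdge u v (vertex t) (vertex (suc t)) ≡ true → ⊥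
      step-∉-closing t t<M same with step-ends (sameEdge-sound {u = u} {v} {vertex t} same) (sameEdge-sound {u = u} {v} {last} closing-uv)
        where
        step-ends : (vertex t ≡ u × vertex (suc t) ≡ v) ⊎ (vertex t ≡ v × vertex (suc t) ≡ u) →
                    (last ≡ u × first ≡ v) ⊎ (last ≡ v × first ≡ u) →
                    vertex t ≡ last ⊎ (vertex t ≡ first × vertex (suc t) ≡ last)
        step-ends (inj₁ (t≡u , _))     (inj₁ (last≡u , _))      = inj₁ (trans t≡u (sym last≡u))
        step-ends (inj₁ (t≡u , 1+t≡v)) (inj₂ (last≡v , first≡u)) =
          inj₂ (trans t≡u (sym first≡u) , trans 1+t≡v (sym last≡v))
        step-ends (inj₂ (t≡v , 1+t≡u)) (inj₁ (last≡u , first≡v)) =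
          inj₂ (trans t≡v (sym first≡v) , trans 1+t≡u (sym last≡u))
        step-ends (inj₂ (t≡v , _))     (inj₂ (last≡v , _))      = inj₁ (trans t≡v (sym last≡v))
      ... | inj₁ t≡last = <-irrefl (injective (<⇒≤ t<M) ≤-refl t≡last) t<M
      ... | inj₂ (t≡first , 1+t≡last) with injective (<⇒≤ t<M) z≤n t≡first | injective t<M ≤-refl 1+t≡last
      ...   | refl | refl = <-irrefl refl 2≤M
      step-in-H : ∀ t → t < M → adj H (vertex t) (vertex (suc t)) ≡ true
      step-in-H t t<M with H′⊆H+uv (vertex t) (vertex (suc t)) (step t t<M)
      ... | inj₁ t~1+t = t~1+t
      ... | inj₂ same  = ⊥-elim (step-∉-closing t t<M same)
      path-in-H : HamPath H
      path-in-H = record { vertex = vertex ; distinct = distinct ; step = step-in-H }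

  -- Rotate an edge of the cycle that is missing from H (necessarily uv) into the closing position,
  -- and apply Ore's lemma to the Hamiltonian path that remains.
  bondy-chvátal : HamCycle H′ → HamCycle H
  bondy-chvátal cyc with adj H (HamCycle.last cyc) (HamCycle.first cyc) in closing
  ... | false = closing-through-uv cyc closing
  ... | true with anyUpTo? (λ t → adj H (vertex t) (vertex (suc t)) Boolₚ.≟ false) M
    where open HamCycle cyc
  ...   | yes (r , r<M , step∉H) =
    closing-through-uv rotated (trans (cong₂ (adj H) rotated-last rotated-first) step∉H)
    where open Rotation cyc r r<M
  ...   | no steps-in-H = record
    { path  = record { vertex = vertex ; distinct = distinct ; step = λ t t<M → ¬-not (λ ∉H → steps-in-H (t , t<M , ∉H)) }
    ; close = closing
    }
    where open HamCycle cyc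

inEdges : ∀ {N} → List (Fin N × Fin N) → Fin N → Fin N → Bool
inEdges []            a b = false
inEdges ((u , v) ∷ L) a b = sameEdge u v a b ∨ inEdges L a b

inEdges-sym : ∀ {N} (L : List (Fin N × Fin N)) a b → inEdges L a b ≡ inEdges L b a
inEdges-sym []            a b = refl
inEdges-sym ((u , v) ∷ L) a b = cong₂ _∨_ (sameEdge-sym u v a b) (inEdges-sym L a b)

inEdges-∈ : ∀ {N} {L : List (Fin N × Fin N)} {a b} → (a , b) ∈ L → inEdges L a b ≡ true
inEdges-∈ {L = (a , b) ∷ L} (here refl)   = ∨-introˡ (inEdges L a b) (sameEdge-refl a b)
inEdges-∈ {L = (u , v) ∷ L} {a} {b} (there ab∈L) = ∨-introʳ (sameEdge u v a b) (inEdges-∈ {L = L} ab∈L)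

_↾_ : ∀ {N} → SimpleGraph N → List (Fin N × Fin N) → SimpleGraph N
S ↾ L = record
  { adj    = λ a b → adj S a b ∧ inEdges L a b
  ; symm   = λ a b → cong₂ _∧_ (symm S a b) (inEdges-sym L a b)
  ; irrefl = λ a → cong (_∧ inEdges L a a) (irrefl S a)
  }

-- The edges of S are added one at a time; Ore's condition in B persists in every larger graph.
module _ {M} (B S : SimpleGraph (suc M)) (2≤M : 2 ≤ M)
  (ore-S : ∀ a b → adj S a b ≡ true → adj B a b ≡ false → suc M ≤ deg B a + deg B b) where

  private
    B+ : List (Fin (suc M) × Fin (suc M)) → SimpleGraph (suc M)
    B+ L = B ∪ᴳ (S ↾ L)

    B+-extend : ∀ u v L a b → adj (B+ ((u , v) ∷ L)) a b ≡ true →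
                adj (B+ L) a b ≡ true ⊎ (sameEdge u v a b ≡ true × adj S a b ≡ true)
    B+-extend u v L a b ab∈ with ∨-elim {adj B a b} ab∈
    ... | inj₁ ab∈B = inj₁ (⊆-∪ˡ B (S ↾ L) a b ab∈B)
    ... | inj₂ ab∈S↾ with ∧-elim {adj S a b} ab∈S↾
    ...   | ab∈S , ab∈uv∷L with ∨-elim {sameEdge u v a b} ab∈uv∷L
    ...     | inj₁ same = inj₂ (same , ab∈S)
    ...     | inj₂ ab∈L = inj₁ (⊆-∪ʳ B (S ↾ L) a b (cong₂ _∧_ ab∈S ab∈L))

    peel : ∀ u v L → HamCycle (B+ ((u , v) ∷ L)) → HamCycle (B+ L)
    peel u v L with adj S u v in uv∈S
    ... | false = hamCycle-mono λ a b ab∈ → case B+-extend u v L a b ab∈ of λ where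
          (inj₁ ab∈B+L)     → ab∈B+L
          (inj₂ (same , ab∈S)) → contradiction (trans (sym ab∈S) (trans (sameEdge-transport (adj S) (symm S) same) uv∈S)) λ ()
    ... | true = bondy-chvátal 2≤M
          (λ a b ab∈ → map₂ proj₁ (B+-extend u v L a b ab∈))
          (λ uv∉B+L → ≤-trans (ore-S u v uv∈S (∨-conicalˡ (adj B u v) _ uv∉B+L))
                              (+-mono-≤ (deg-∪ˡ B (S ↾ L) u) (deg-∪ˡ B (S ↾ L) v)))

    shrink : ∀ L → HamCycle (B+ L) → HamCycle B
    shrink []            = hamCycle-mono λ a b ab∈ →
      trans (sym (∨-identityʳ _)) (trans (cong (adj B a b ∨_) (sym (∧-zeroʳ (adj S a b)))) ab∈)
    shrink ((u , v) ∷ L) cyc = shrink L (peel u v L cyc)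

  closure : HamCycle (B ∪ᴳ S) → HamCycle B
  closure = shrink allPairs ∘ hamCycle-mono (λ a b ab∈ → case ∨-elim {adj B a b} ab∈ of λ where
      (inj₁ ab∈B) → ⊆-∪ˡ B (S ↾ allPairs) a b ab∈B
      (inj₂ ab∈S) → ⊆-∪ʳ B (S ↾ allPairs) a b
        (cong₂ _∧_ ab∈S (inEdges-∈ {L = allPairs} (∈-cartesianProduct⁺ (∈-allFin a) (∈-allFin b)))))
    where
    allPairs : List (Fin (suc M) × Fin (suc M))
    allPairs = cartesianProduct (allFin (suc M)) (allFin (suc M))

hamCycle⇒hamiltonian : ∀ {M} {G : SimpleGraph (suc M)} → 2 ≤ M → HamCycle G → Hamiltonian G
hamCycle⇒hamiltonian {M} {G} 2≤M cyc = s≤s 2≤M , vertexAt , vertexAt-injective , consecutive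
  where
  open HamCycle cyc
  consecutive : ∀ i j → suc (toℕ i) ≡ toℕ j ⊎ (suc (toℕ i) ≡ suc M × toℕ j ≡ 0) →
                adj G (vertexAt i) (vertexAt j) ≡ true
  consecutive i j (inj₁ 1+i≡j) = subst (λ t → adj G (vertexAt i) (vertex t) ≡ true) 1+i≡j
    (step (toℕ i) (subst (_≤ M) (sym 1+i≡j) (s≤s⁻¹ (Finₚ.toℕ<n j))))
  consecutive i j (inj₂ (1+i≡1+M , j≡0)) =
    subst₂ (λ s t → adj G (vertex s) (vertex t) ≡ true) (sym (suc-injective 1+i≡1+M)) (sym j≡0) close

-- Balanced multipartite graphs

module BalancedMultipartite {M k} (G : SimpleGraph (suc M)) (part : Fin (suc M) → Fin k) (n D : ℕ)
  (part-size : ∀ v → count (λ w → part v == part w) ≡ n)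
  (part-independent : ∀ a b → part a ≡ part b → adj G a b ≡ false)
  (D+n≡N : D + n ≡ suc M) (n≤D : n ≤ D) (1≤n : 1 ≤ n) (2≤M : 2 ≤ M) where

  V : Set
  V = Fin (suc M)

  samePart : V → V → Bool
  samePart a b = part a == part b

  samePart-sym : ∀ a b → samePart a b ≡ samePart b a
  samePart-sym a b = ==-sym (part a) (part b)

  samePart-refl : ∀ a → samePart a a ≡ true
  samePart-refl a = ==-refl (part a)

  samePart-trans : ∀ {x a b} → samePart x a ≡ true → samePart x b ≡ true → samePart a b ≡ true
  samePart-trans {x} {a} {b} xa xb =
    trans (cong₂ _==_ (sym (==⇒≡ {a = part x} xa)) (sym (==⇒≡ {a = part x} xb))) (==-refl (part x))

  adj⇒crossPart : ∀ {a b} → adj G a b ≡ true → samePart a b ≡ false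
  adj⇒crossPart {a} {b} a~b with samePart a b in ab
  ... | false = refl
  ... | true  = contradiction (trans (sym a~b) (part-independent a b (==⇒≡ {a = part a} ab))) λ ()

  missing : V → V → Bool
  missing a b = not (samePart a b) ∧ not (adj G a b)

  missing-sym : ∀ a b → missing a b ≡ missing b a
  missing-sym a b = cong₂ (λ s e → not s ∧ not e) (samePart-sym a b) (symm G a b)

  deficit : V → ℕ
  deficit a = count (missing a)

  deg+deficit≡D : ∀ a → deg G a + deficit a ≡ D
  deg+deficit≡D a = +-cancelʳ-≡ n _ _ (begin
    deg G a + deficit a + n
      ≡⟨ cong (_+ n) (sym (∑-distrib-+ (λ b → when (adj G a b) 1) (λ b → when (missing a b) 1))) ⟩
    sum (λ b → when (adj G a b) 1 + when (missing a b) 1) + n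
      ≡⟨ cong (_+ n) (sum-cong (λ b → cross-part b (adj G a b) refl)) ⟩
    count (λ b → not (samePart a b)) + n
      ≡⟨ cong (count (λ b → not (samePart a b)) +_) (sym (part-size a)) ⟩
    count (λ b → not (samePart a b)) + count (samePart a)
      ≡⟨ +-comm _ (count (samePart a)) ⟩
    count (samePart a) + count (λ b → not (samePart a b))
      ≡⟨ count-compl (samePart a) ⟩
    suc M
      ≡⟨ sym D+n≡N ⟩
    D + n ∎)
    where
    open ≡-Reasoning
    cross-part : ∀ b e → adj G a b ≡ e → when e 1 + when (not (samePart a b) ∧ not e) 1 ≡ when (not (samePart a b)) 1
    cross-part b true  a~b rewrite adj⇒crossPart a~b = refl
    cross-part b false _ with samePart a b
    ... | true  = refl
    ... | false = refl

  Σ[_]_ : (V → Bool) → (V → ℕ) → ℕ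
  Σ[ S ] f = sum (λ a → when (S a) (f a))

  missingWithin : (V → Bool) → ℕ
  missingWithin S = sum (λ a → sum (λ b → when (S a ∧ S b) (when (missing a b) 1)))

  -- Σ[ S ] deficit counts the non-adjacent cross-part pairs with an endpoint in S, and twice
  -- those with both endpoints in S.
  deficit-double-count : ∀ S → Σ[ S ] deficit + Σ[ S ] deficit ≤ sum deficit + missingWithin S
  deficit-double-count S = begin
    Σ[ S ] deficit + Σ[ S ] deficit
      ≡⟨ cong₂ _+_ (sum-cong (λ a → sym (sum-when (S a) (m a))))
                   (sum-cong (λ b → trans (sym (sum-when (S b) (m b))) (sum-cong (λ a → cong (when (S b)) (m-sym b a))))) ⟩
    sum (λ a → sum (λ b → when (S a) (m a b))) + sum (λ b → sum (λ a → when (S b) (m a b)))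
      ≡⟨ cong (sum (λ a → sum (λ b → when (S a) (m a b))) +_) (∑-comm (λ a b → when (S b) (m a b))) ⟨
    sum (λ a → sum (λ b → when (S a) (m a b))) + sum (λ a → sum (λ b → when (S b) (m a b)))
      ≡⟨ ∑-distrib-+ (λ a → sum (λ b → when (S a) (m a b))) (λ a → sum (λ b → when (S b) (m a b))) ⟨
    sum (λ a → sum (λ b → when (S a) (m a b)) + sum (λ b → when (S b) (m a b)))
      ≡⟨ sum-cong (λ a → sym (∑-distrib-+ (λ b → when (S a) (m a b)) (λ b → when (S b) (m a b)))) ⟩
    sum (λ a → sum (λ b → when (S a) (m a b) + when (S b) (m a b)))
      ≡⟨ sum-cong (λ a → sum-cong (λ b → sym (when-∨-∧ (S a) (S b) (m a b)))) ⟩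
    sum (λ a → sum (λ b → when (S a ∨ S b) (m a b) + when (S a ∧ S b) (m a b)))
      ≡⟨ sum-cong (λ a → ∑-distrib-+ (λ b → when (S a ∨ S b) (m a b)) (λ b → when (S a ∧ S b) (m a b))) ⟩
    sum (λ a → sum (λ b → when (S a ∨ S b) (m a b)) + sum (λ b → when (S a ∧ S b) (m a b)))
      ≡⟨ ∑-distrib-+ (λ a → sum (λ b → when (S a ∨ S b) (m a b))) (λ a → sum (λ b → when (S a ∧ S b) (m a b))) ⟩
    sum (λ a → sum (λ b → when (S a ∨ S b) (m a b))) + missingWithin S
      ≤⟨ +-monoˡ-≤ (missingWithin S) (sum-mono (λ a → sum-mono (λ b → when-≤ (S a ∨ S b) (m a b)))) ⟩
    sum deficit + missingWithin S ∎
    where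
    open ≤-Reasoning
    m : V → V → ℕ
    m a b = when (missing a b) 1
    m-sym : ∀ a b → m a b ≡ m b a
    m-sym a b = cong (λ x → when x 1) (missing-sym a b)

  infixl 20 _∖_
  _∖_ : (V → Bool) → V → V → Bool
  (S ∖ b) a = S a ∧ not (a == b)

  Σ-remove : ∀ S f {b} → S b ≡ true → Σ[ S ] f ≡ f b + Σ[ S ∖ b ] f
  Σ-remove S f {b} b∈S = trans (sum-when-remove S f b) (cong (λ x → when x (f b) + Σ[ S ∖ b ] f) b∈S)

  saturated : V → Bool
  saturated a = deficit a ≡ᵇ 0

  saturated-deg : ∀ {a} → saturated a ≡ true → deg G a ≡ D
  saturated-deg {a} sat = trans (sym (+-identityʳ _)) (trans (cong (deg G a +_) (deficit≡0 (deficit a) sat)) (deg+deficit≡D a))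
    where
    deficit≡0 : ∀ x → (x ≡ᵇ 0) ≡ true → 0 ≡ x
    deficit≡0 zero _ = refl

  unsaturated-deficit : ∀ {a} → saturated a ≡ false → 1 ≤ deficit a
  unsaturated-deficit {a} unsat = positive (deficit a) unsat
    where
    positive : ∀ x → (x ≡ᵇ 0) ≡ false → 1 ≤ x
    positive (suc x) _ = s≤s z≤n

  satIn unsatIn : V → V → Bool
  satIn   x c = samePart x c ∧ saturated c
  unsatIn x c = samePart x c ∧ not (saturated c)

  part-size-split : ∀ x → n ≡ count (satIn x) + count (unsatIn x)
  part-size-split x = trans (sym (part-size x)) (count-split (samePart x) saturated)

  intraPart : (R : V → V → Bool) → (∀ a b → R a b ≡ R b a) → SimpleGraph (suc M)
  intraPart R R-sym = record
    { adj    = λ a b → (samePart a b ∧ R a b) ∧ not (b == a)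
    ; symm   = λ a b → cong₂ (λ s e → s ∧ not e) (cong₂ _∧_ (samePart-sym a b) (R-sym a b)) (==-sym b a)
    ; irrefl = λ a → trans (cong (λ e → (samePart a a ∧ R a a) ∧ not e) (==-refl a)) (∧-zeroʳ _)
    }

  intraPart-adj : ∀ {R : V → V → Bool} {a b} → ((samePart a b ∧ R a b) ∧ not (b == a)) ≡ true →
    samePart a b ≡ true × R a b ≡ true × (b == a) ≡ false
  intraPart-adj {R} {a = a} {b} a~b with ∧-elim {samePart a b ∧ R a b} a~b
  ... | same∧R , b≠a with ∧-elim {samePart a b} same∧R
  ...   | same , R-ab = same , R-ab , not-true b≠a

  deg-∪-intraPart : ∀ R R-sym x → deg (G ∪ᴳ intraPart R R-sym) x ≡ deg G x + deg (intraPart R R-sym) x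
  deg-∪-intraPart R R-sym x = sum-when-∨ (adj G x) (adj (intraPart R R-sym) x) (λ _ → 1) disjoint
    where
    disjoint : ∀ c → (adj G x c ∧ adj (intraPart R R-sym) x c) ≡ false
    disjoint c with adj G x c in x~c
    ... | false = refl
    ... | true rewrite adj⇒crossPart x~c = refl

  deg+deficit-sum : sum (deg G) + sum deficit ≡ suc M * D
  deg+deficit-sum = trans (sym (∑-distrib-+ (deg G) deficit)) (trans (sum-cong deg+deficit≡D) (sum-const (suc M) D))

  edges⇒few-missing : ∀ c → c + c ≡ suc M * D → c + 2 ≤ edgeCount G + D → sum deficit + 4 ≤ D + D
  edges⇒few-missing c c+c≡ND dense = +-cancelˡ-≤ (sum (deg G)) _ _ (begin
    sum (deg G) + (sum deficit + 4)     ≡⟨ +-assoc (sum (deg G)) (sum deficit) 4 ⟨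
    sum (deg G) + sum deficit + 4       ≡⟨ cong (_+ 4) (trans deg+deficit-sum (sym c+c≡ND)) ⟩
    c + c + 4                           ≡⟨ rearrange c ⟩
    (c + 2) + (c + 2)                   ≤⟨ +-mono-≤ dense dense ⟩
    (edgeCount G + D) + (edgeCount G + D) ≡⟨ rearrange′ (edgeCount G) D ⟩
    (edgeCount G + edgeCount G) + (D + D) ≡⟨ cong (_+ (D + D)) (handshake G) ⟨
    sum (deg G) + (D + D) ∎)
    where
    open ≤-Reasoning
    rearrange : ∀ x → x + x + 4 ≡ (x + 2) + (x + 2)
    rearrange = solve-∀
    rearrange′ : ∀ e d → (e + d) + (e + d) ≡ (e + e) + (d + d)
    rearrange′ = solve-∀

  module Dense (few-missing : sum deficit + 4 ≤ D + D) where

    part-deficit-bound : ∀ S → (∀ a b → S a ≡ true → S b ≡ true → samePart a b ≡ true) → Σ[ S ] deficit + 2 ≤ D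
    part-deficit-bound S within = m+m≤n+n⇒m≤n (begin
      (Σ[ S ] deficit + 2) + (Σ[ S ] deficit + 2)   ≡⟨ rearrange (Σ[ S ] deficit) ⟩
      (Σ[ S ] deficit + Σ[ S ] deficit) + 4         ≤⟨ +-monoˡ-≤ 4 (deficit-double-count S) ⟩
      sum deficit + missingWithin S + 4             ≡⟨ cong (λ x → sum deficit + x + 4) none-missing ⟩
      sum deficit + 0 + 4                           ≡⟨ cong (_+ 4) (+-identityʳ _) ⟩
      sum deficit + 4                               ≤⟨ few-missing ⟩
      D + D ∎)
      where
      open ≤-Reasoning
      rearrange : ∀ x → (x + 2) + (x + 2) ≡ (x + x) + 4
      rearrange = solve-∀
      inside : ∀ a b (s t : Bool) → (s ≡ true → t ≡ true → samePart a b ≡ true) →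
               when (s ∧ t) (when (missing a b) 1) ≡ 0
      inside a b true true same rewrite same refl refl = refl
      inside a b true false _ = refl
      inside a b false t _ = refl
      none-missing : missingWithin S ≡ 0
      none-missing = trans (sum-cong (λ a → trans (sum-cong (λ b → inside a b (S a) (S b) (within a b))) (sum-zero (suc M))))
                           (sum-zero (suc M))

    pair-deficit-bound : ∀ {u v} → u ≢ v → deficit u + deficit v + 1 ≤ D
    pair-deficit-bound {u} {v} u≢v = m+m≤n+n⇒m≤n (begin
      (deficit u + deficit v + 1) + (deficit u + deficit v + 1)   ≡⟨ rearrange (deficit u + deficit v) ⟩
      (deficit u + deficit v) + (deficit u + deficit v) + 2       ≡⟨ cong (λ x → x + x + 2) (sym (sum-pair u≢v deficit)) ⟩
      (Σ[ S ] deficit + Σ[ S ] deficit) + 2                       ≤⟨ +-monoˡ-≤ 2 (deficit-double-count S) ⟩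
      sum deficit + missingWithin S + 2                           ≤⟨ +-monoˡ-≤ 2 (+-monoʳ-≤ (sum deficit) missingWithin-≤2) ⟩
      sum deficit + 2 + 2                                         ≡⟨ +-assoc (sum deficit) 2 2 ⟩
      sum deficit + 4                                             ≤⟨ few-missing ⟩
      D + D ∎)
      where
      open ≤-Reasoning
      rearrange : ∀ x → (x + 1) + (x + 1) ≡ x + x + 2
      rearrange = solve-∀
      S : V → Bool
      S a = (a == u) ∨ (a == v)
      m : V → V → ℕ
      m a b = when (missing a b) 1
      m-diag : ∀ a → m a a ≡ 0
      m-diag a = cong (λ s → when (not s ∧ not (adj G a a)) 1) (samePart-refl a)
      missingWithin-≤2 : missingWithin S ≤ 2
      missingWithin-≤2 = begin
        missingWithin S
          ≡⟨ sum-cong (λ a → trans (sum-cong (λ b → when-∧ (S a) (S b) (m a b)))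
                                   (sum-when (S a) (λ b → when (S b) (m a b)))) ⟩
        Σ[ S ] (λ a → Σ[ S ] (m a))
          ≡⟨ sum-pair u≢v (λ a → Σ[ S ] (m a)) ⟩
        Σ[ S ] (m u) + Σ[ S ] (m v)
          ≡⟨ cong₂ _+_ (sum-pair u≢v (m u)) (sum-pair u≢v (m v)) ⟩
        (m u u + m u v) + (m v u + m v v)
          ≡⟨ cong₂ (λ x y → (x + m u v) + (m v u + y)) (m-diag u) (m-diag v) ⟩
        m u v + (m v u + 0)
          ≤⟨ +-mono-≤ (when-≤ (missing u v) 1) (≤-trans (≤-reflexive (+-identityʳ _)) (when-≤ (missing v u) 1)) ⟩
        2 ∎

    unsatIn⇒unsaturated : ∀ {x a} → unsatIn x a ≡ true → saturated a ≡ false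
    unsatIn⇒unsaturated {x} {a} xa = not-true (proj₂ (∧-elim {samePart x a} xa))

    ∖-⊆ : ∀ S {b a} → (S ∖ b) a ≡ true → S a ≡ true
    ∖-⊆ S {b} {a} a∈S∖b = proj₁ (∧-elim {S a} a∈S∖b)

    unsaturated-count-≤ : ∀ S → (∀ a → S a ≡ true → saturated a ≡ false) → count S ≤ Σ[ S ] deficit
    unsaturated-count-≤ S unsat = count-≤-sum S deficit (λ a a∈S → unsaturated-deficit (unsat a a∈S))

    unsaturated-part-bound : ∀ x → Σ[ unsatIn x ] deficit + 2 ≤ D
    unsaturated-part-bound x = part-deficit-bound (unsatIn x)
      λ a b xa xb → samePart-trans (proj₁ (∧-elim {samePart x a} xa)) (proj₁ (∧-elim {samePart x b} xb))

    unsaturated-bound : ∀ {x y} → unsatIn x y ≡ true → deficit y + count (unsatIn x) + 1 ≤ D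
    unsaturated-bound {x} {y} y∈T = begin
      deficit y + count T + 1
        ≡⟨ cong (λ c → deficit y + c + 1) (Σ-remove T (λ _ → 1) y∈T) ⟩
      deficit y + (1 + count (T ∖ y)) + 1
        ≡⟨ rearrange (deficit y) (count (T ∖ y)) ⟩
      deficit y + count (T ∖ y) + 2
        ≤⟨ +-monoˡ-≤ 2 (+-monoʳ-≤ (deficit y) (unsaturated-count-≤ (T ∖ y) (λ a a∈ → unsatIn⇒unsaturated (∖-⊆ T a∈)))) ⟩
      deficit y + Σ[ T ∖ y ] deficit + 2
        ≡⟨ cong (_+ 2) (Σ-remove T deficit y∈T) ⟨
      Σ[ T ] deficit + 2
        ≤⟨ unsaturated-part-bound x ⟩
      D ∎
      where
      open ≤-Reasoning
      T : V → Bool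
      T = unsatIn x
      rearrange : ∀ a c → a + (1 + c) + 1 ≡ a + c + 2
      rearrange = solve-∀

    unsaturated-pair-bound : ∀ {x y} → saturated x ≡ false → unsatIn x y ≡ true → (y == x) ≡ false →
      deficit x + deficit y + count (unsatIn x) ≤ D
    unsaturated-pair-bound {x} {y} x-unsat y∈T y≠x = begin
      deficit x + deficit y + count T
        ≡⟨ cong (deficit x + deficit y +_) (Σ-remove T (λ _ → 1) x∈T) ⟩
      deficit x + deficit y + (1 + count (T ∖ x))
        ≡⟨ cong (λ c → deficit x + deficit y + (1 + c)) (Σ-remove (T ∖ x) (λ _ → 1) y∈T∖x) ⟩
      deficit x + deficit y + (1 + (1 + count (T ∖ x ∖ y)))
        ≡⟨ rearrange (deficit x) (deficit y) (count (T ∖ x ∖ y)) ⟩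
      deficit x + (deficit y + count (T ∖ x ∖ y)) + 2
        ≤⟨ +-monoˡ-≤ 2 (+-monoʳ-≤ (deficit x) (+-monoʳ-≤ (deficit y) (unsaturated-count-≤ (T ∖ x ∖ y)
             (λ a a∈ → unsatIn⇒unsaturated (∖-⊆ T (∖-⊆ (T ∖ x) a∈)))))) ⟩
      deficit x + (deficit y + Σ[ T ∖ x ∖ y ] deficit) + 2
        ≡⟨ cong (λ s → deficit x + s + 2) (Σ-remove (T ∖ x) deficit y∈T∖x) ⟨
      deficit x + Σ[ T ∖ x ] deficit + 2
        ≡⟨ cong (_+ 2) (Σ-remove T deficit x∈T) ⟨
      Σ[ T ] deficit + 2
        ≤⟨ unsaturated-part-bound x ⟩
      D ∎
      where
      open ≤-Reasoning
      T : V → Bool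
      T = unsatIn x
      x∈T : T x ≡ true
      x∈T = cong₂ (λ s u → s ∧ not u) (samePart-refl x) x-unsat
      y∈T∖x : (T ∖ x) y ≡ true
      y∈T∖x = cong₂ (λ t e → t ∧ not e) y∈T y≠x
      rearrange : ∀ a b c → a + b + (1 + (1 + c)) ≡ a + (b + c) + 2
      rearrange = solve-∀

    unsaturated-deg : ∀ {x y} → unsatIn x y ≡ true → count (unsatIn x) + 1 ≤ deg G y
    unsaturated-deg {x} {y} y∈T = +-cancelʳ-≤ (deficit y) _ _ (begin
      count (unsatIn x) + 1 + deficit y   ≡⟨ rearrange (count (unsatIn x)) (deficit y) ⟩
      deficit y + count (unsatIn x) + 1   ≤⟨ unsaturated-bound y∈T ⟩
      D                                   ≡⟨ deg+deficit≡D y ⟨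
      deg G y + deficit y ∎)
      where
      open ≤-Reasoning
      rearrange : ∀ u d → u + 1 + d ≡ d + u + 1
      rearrange = solve-∀

    unsaturated-pair-deg : ∀ {x y} → saturated x ≡ false → unsatIn x y ≡ true → (y == x) ≡ false →
      D + count (unsatIn x) ≤ deg G x + deg G y
    unsaturated-pair-deg {x} {y} x-unsat y∈T y≠x = +-cancelʳ-≤ (deficit x + deficit y) _ _ (begin
      D + count (unsatIn x) + (deficit x + deficit y)   ≡⟨ rearrange D (count (unsatIn x)) (deficit x) (deficit y) ⟩
      D + (deficit x + deficit y + count (unsatIn x))   ≤⟨ +-monoʳ-≤ D (unsaturated-pair-bound x-unsat y∈T y≠x) ⟩
      D + D                                             ≡⟨ cong₂ _+_ (deg+deficit≡D x) (deg+deficit≡D y) ⟨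
      (deg G x + deficit x) + (deg G y + deficit y)     ≡⟨ rearrange′ (deg G x) (deficit x) (deg G y) (deficit y) ⟩
      deg G x + deg G y + (deficit x + deficit y) ∎)
      where
      open ≤-Reasoning
      rearrange : ∀ d u a b → d + u + (a + b) ≡ d + (a + b + u)
      rearrange = solve-∀
      rearrange′ : ∀ g a h b → (g + a) + (h + b) ≡ g + h + (a + b)
      rearrange′ = solve-∀

    pair-deg : ∀ {a b} → a ≢ b → D + 1 ≤ deg G a + deg G b
    pair-deg {a} {b} a≢b = +-cancelʳ-≤ (deficit a + deficit b) _ _ (begin
      D + 1 + (deficit a + deficit b)                   ≡⟨ rearrange D (deficit a) (deficit b) ⟩
      D + (deficit a + deficit b + 1)                   ≤⟨ +-monoʳ-≤ D (pair-deficit-bound a≢b) ⟩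
      D + D                                             ≡⟨ cong₂ _+_ (deg+deficit≡D a) (deg+deficit≡D b) ⟨
      (deg G a + deficit a) + (deg G b + deficit b)     ≡⟨ rearrange′ (deg G a) (deficit a) (deg G b) (deficit b) ⟩
      deg G a + deg G b + (deficit a + deficit b) ∎)
      where
      open ≤-Reasoning
      rearrange : ∀ d x y → d + 1 + (x + y) ≡ d + (x + y + 1)
      rearrange = solve-∀
      rearrange′ : ∀ g x h y → (g + x) + (h + y) ≡ g + h + (x + y)
      rearrange′ = solve-∀

    xor-comm : ∀ x y → (x xor y) ≡ (y xor x)
    xor-comm true  true  = refl
    xor-comm true  false = refl
    xor-comm false true  = refl
    xor-comm false false = refl

    bothSaturated oneSaturated noneSaturated : V → V → Bool
    bothSaturated a b = saturated a ∧ saturated b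
    oneSaturated  a b = saturated a xor saturated b
    noneSaturated a b = not (saturated a) ∧ not (saturated b)

    bothSaturated-sym : ∀ a b → bothSaturated a b ≡ bothSaturated b a
    bothSaturated-sym a b = ∧-comm (saturated a) (saturated b)

    oneSaturated-sym : ∀ a b → oneSaturated a b ≡ oneSaturated b a
    oneSaturated-sym a b = xor-comm (saturated a) (saturated b)

    noneSaturated-sym : ∀ a b → noneSaturated a b ≡ noneSaturated b a
    noneSaturated-sym a b = ∧-comm (not (saturated a)) (not (saturated b))

    S₁ S₂ S₃ : SimpleGraph (suc M)
    S₁ = intraPart bothSaturated bothSaturated-sym
    S₂ = intraPart oneSaturated  oneSaturated-sym
    S₃ = intraPart noneSaturated noneSaturated-sym

    H₁ H₂ H₃ : SimpleGraph (suc M)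
    H₁ = G ∪ᴳ S₁
    H₂ = H₁ ∪ᴳ S₂
    H₃ = H₂ ∪ᴳ S₃

    ore-S₁ : ∀ a b → adj S₁ a b ≡ true → adj G a b ≡ false → suc M ≤ deg G a + deg G b
    ore-S₁ a b ab∈S₁ _ with intraPart-adj {bothSaturated} {a} {b} ab∈S₁
    ... | _ , both-sat , _ with ∧-elim {saturated a} both-sat
    ...   | a-sat , b-sat = begin
      suc M                ≡⟨ D+n≡N ⟨
      D + n                ≤⟨ +-monoʳ-≤ D n≤D ⟩
      D + D                ≡⟨ cong₂ _+_ (saturated-deg a-sat) (saturated-deg b-sat) ⟨
      deg G a + deg G b ∎
      where open ≤-Reasoning

    saturated-deg-H₁ : ∀ {x} → saturated x ≡ true → D + count (satIn x) ≡ deg H₁ x + 1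
    saturated-deg-H₁ {x} x-sat = begin
      D + count (satIn x)                ≡⟨ cong (D +_) (Σ-remove (satIn x) (λ _ → 1) x∈Z) ⟩
      D + (1 + count (satIn x ∖ x))      ≡⟨ cong (λ c → D + (1 + c)) (count-cong S₁-neighbours) ⟩
      D + (1 + deg S₁ x)                 ≡⟨ rearrange D (deg S₁ x) ⟩
      D + deg S₁ x + 1                   ≡⟨ cong (λ g → g + deg S₁ x + 1) (saturated-deg x-sat) ⟨
      deg G x + deg S₁ x + 1             ≡⟨ cong (_+ 1) (deg-∪-intraPart bothSaturated bothSaturated-sym x) ⟨
      deg H₁ x + 1 ∎
      where
      open ≡-Reasoning
      x∈Z : satIn x x ≡ true
      x∈Z = cong₂ _∧_ (samePart-refl x) x-sat
      S₁-neighbours : ∀ c → (satIn x ∖ x) c ≡ adj S₁ x c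
      S₁-neighbours c = cong (λ s → (samePart x c ∧ (s ∧ saturated c)) ∧ not (c == x)) (sym x-sat)
      rearrange : ∀ d s → d + (1 + s) ≡ d + s + 1
      rearrange = solve-∀

    saturated-unsaturated-ore : ∀ {x y} → samePart x y ≡ true → saturated x ≡ true → saturated y ≡ false →
      suc M ≤ deg H₁ x + deg H₁ y
    saturated-unsaturated-ore {x} {y} xy x-sat y-unsat = +-cancelʳ-≤ 1 _ _ (begin
      suc M + 1
        ≡⟨ cong (_+ 1) D+n≡N ⟨
      D + n + 1
        ≡⟨ cong (λ m → D + m + 1) (part-size-split x) ⟩
      D + (count (satIn x) + count (unsatIn x)) + 1
        ≡⟨ rearrange D (count (satIn x)) (count (unsatIn x)) ⟩
      (D + count (satIn x)) + (count (unsatIn x) + 1)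
        ≤⟨ +-mono-≤ (≤-reflexive (saturated-deg-H₁ x-sat)) (unsaturated-deg y∈T) ⟩
      (deg H₁ x + 1) + deg G y
        ≤⟨ +-monoʳ-≤ (deg H₁ x + 1) (deg-∪ˡ G S₁ y) ⟩
      (deg H₁ x + 1) + deg H₁ y
        ≡⟨ rearrange′ (deg H₁ x) (deg H₁ y) ⟩
      deg H₁ x + deg H₁ y + 1 ∎)
      where
      open ≤-Reasoning
      y∈T : unsatIn x y ≡ true
      y∈T = cong₂ (λ s t → s ∧ not t) xy y-unsat
      rearrange : ∀ d z u → d + (z + u) + 1 ≡ (d + z) + (u + 1)
      rearrange = solve-∀
      rearrange′ : ∀ a b → (a + 1) + b ≡ a + b + 1
      rearrange′ = solve-∀

    ore-S₂ : ∀ a b → adj S₂ a b ≡ true → adj H₁ a b ≡ false → suc M ≤ deg H₁ a + deg H₁ b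
    ore-S₂ a b ab∈S₂ _ with intraPart-adj {oneSaturated} {a} {b} ab∈S₂
    ... | ab , one-sat , _ = by-cases (saturated a) (saturated b) refl refl one-sat
      where
      by-cases : ∀ s t → saturated a ≡ s → saturated b ≡ t → (s xor t) ≡ true → suc M ≤ deg H₁ a + deg H₁ b
      by-cases true  false a-sat b-unsat _ = saturated-unsaturated-ore ab a-sat b-unsat
      by-cases false true  a-unsat b-sat _ = subst (suc M ≤_) (+-comm (deg H₁ b) (deg H₁ a))
        (saturated-unsaturated-ore (trans (samePart-sym b a) ab) b-sat a-unsat)

    unsaturated-deg-H₂ : ∀ {x} → saturated x ≡ false → deg G x + count (satIn x) ≤ deg H₂ x
    unsaturated-deg-H₂ {x} x-unsat = begin
      deg G x + count (satIn x)           ≡⟨ cong (deg G x +_) (sum-when-remove (satIn x) (λ _ → 1) x) ⟩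
      deg G x + (when (satIn x x) 1 + count (satIn x ∖ x))
                                          ≡⟨ cong (λ s → deg G x + (when s 1 + count (satIn x ∖ x))) x∉Z ⟩
      deg G x + count (satIn x ∖ x)       ≡⟨ cong (deg G x +_) (count-cong S₂-neighbours) ⟩
      deg G x + deg S₂ x                  ≡⟨ deg-∪-intraPart oneSaturated oneSaturated-sym x ⟨
      deg (G ∪ᴳ S₂) x                     ≤⟨ deg-mono {G = G ∪ᴳ S₂} {H₂} G∪S₂⊆H₂ x ⟩
      deg H₂ x ∎
      where
      open ≤-Reasoning
      x∉Z : satIn x x ≡ false
      x∉Z = trans (cong (samePart x x ∧_) x-unsat) (∧-zeroʳ _)
      S₂-neighbours : ∀ c → (satIn x ∖ x) c ≡ adj S₂ x c
      S₂-neighbours c = cong (λ s → (samePart x c ∧ (s xor saturated c)) ∧ not (c == x)) (sym x-unsat)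
      G∪S₂⊆H₂ : (G ∪ᴳ S₂) ⊆ᴳ H₂
      G∪S₂⊆H₂ a b ab∈ with ∨-elim {adj G a b} ab∈
      ... | inj₁ ab∈G  = ⊆-∪ˡ H₁ S₂ a b (⊆-∪ˡ G S₁ a b ab∈G)
      ... | inj₂ ab∈S₂ = ⊆-∪ʳ H₁ S₂ a b ab∈S₂

    ore-S₃ : ∀ a b → adj S₃ a b ≡ true → adj H₂ a b ≡ false → suc M ≤ deg H₂ a + deg H₂ b
    ore-S₃ a b ab∈S₃ _ with intraPart-adj {noneSaturated} {a} {b} ab∈S₃
    ... | ab , none-sat , b≠a with ∧-elim {not (saturated a)} none-sat
    ...   | a-unsat , b-unsat = begin
      suc M
        ≡⟨ D+n≡N ⟨
      D + n
        ≡⟨ cong (D +_) (part-size-split a) ⟩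
      D + (count (satIn a) + count (unsatIn a))
        ≡⟨ rearrange D (count (satIn a)) (count (unsatIn a)) ⟩
      (D + count (unsatIn a)) + count (satIn a)
        ≤⟨ +-monoˡ-≤ (count (satIn a)) (unsaturated-pair-deg (not-true a-unsat) (cong₂ _∧_ ab b-unsat) b≠a) ⟩
      deg G a + deg G b + count (satIn a)
        ≡⟨ rearrange′ (deg G a) (deg G b) (count (satIn a)) ⟩
      (deg G a + count (satIn a)) + deg G b
        ≤⟨ +-mono-≤ (unsaturated-deg-H₂ (not-true a-unsat)) (deg-mono {G = G} {H₂} G⊆H₂ b) ⟩
      deg H₂ a + deg H₂ b ∎
      where
      open ≤-Reasoning
      G⊆H₂ : G ⊆ᴳ H₂
      G⊆H₂ a b ab∈G = ⊆-∪ˡ H₁ S₂ a b (⊆-∪ˡ G S₁ a b ab∈G)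
      rearrange : ∀ d z u → d + (z + u) ≡ (d + u) + z
      rearrange = solve-∀
      rearrange′ : ∀ g h z → g + h + z ≡ (g + z) + h
      rearrange′ = solve-∀

    same-part-⊆-H₃ : ∀ {a b} → samePart a b ≡ true → (b == a) ≡ false → adj H₃ a b ≡ true
    same-part-⊆-H₃ {a} {b} ab b≠a = by-cases (saturated a) (saturated b) refl refl
      where
      in-S : ∀ R → R a b ≡ true → ((samePart a b ∧ R a b) ∧ not (b == a)) ≡ true
      in-S R R-ab = trans (cong₂ (λ p e → (p ∧ R a b) ∧ not e) ab b≠a) (cong (λ r → r ∧ true) R-ab)
      by-cases : ∀ s t → saturated a ≡ s → saturated b ≡ t → adj H₃ a b ≡ true
      by-cases true  true  a-sat b-sat = ⊆-∪ˡ H₂ S₃ a b (⊆-∪ˡ H₁ S₂ a b (⊆-∪ʳ G S₁ a b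
        (in-S bothSaturated (cong₂ _∧_ a-sat b-sat))))
      by-cases true  false a-sat b-sat = ⊆-∪ˡ H₂ S₃ a b (⊆-∪ʳ H₁ S₂ a b
        (in-S oneSaturated (cong₂ _xor_ a-sat b-sat)))
      by-cases false true  a-sat b-sat = ⊆-∪ˡ H₂ S₃ a b (⊆-∪ʳ H₁ S₂ a b
        (in-S oneSaturated (cong₂ _xor_ a-sat b-sat)))
      by-cases false false a-sat b-sat = ⊆-∪ʳ H₂ S₃ a b
        (in-S noneSaturated (cong₂ (λ s t → not s ∧ not t) a-sat b-sat))

    deg-H₃ : ∀ v → deg G v + n ≤ deg H₃ v + 1
    deg-H₃ v = begin
      deg G v + n
        ≡⟨ cong (deg G v +_) (trans (sym (part-size v)) (Σ-remove (samePart v) (λ _ → 1) (samePart-refl v))) ⟩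
      deg G v + (1 + count (samePart v ∖ v))
        ≡⟨ cong (λ c → deg G v + (1 + c)) (count-cong (λ c → cong (λ s → s ∧ not (c == v)) (sym (∧-identityʳ (samePart v c))))) ⟩
      deg G v + (1 + deg K v)
        ≡⟨ rearrange (deg G v) (deg K v) ⟩
      deg G v + deg K v + 1
        ≡⟨ cong (_+ 1) (deg-∪-intraPart (λ _ _ → true) (λ _ _ → refl) v) ⟨
      deg (G ∪ᴳ K) v + 1
        ≤⟨ +-monoˡ-≤ 1 (deg-mono {G = G ∪ᴳ K} {H₃} G∪K⊆H₃ v) ⟩
      deg H₃ v + 1 ∎
      where
      open ≤-Reasoning
      K : SimpleGraph (suc M)
      K = intraPart (λ _ _ → true) (λ _ _ → refl)
      G∪K⊆H₃ : (G ∪ᴳ K) ⊆ᴳ H₃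
      G∪K⊆H₃ a b ab∈ with ∨-elim {adj G a b} ab∈
      ... | inj₁ ab∈G = ⊆-∪ˡ H₂ S₃ a b (⊆-∪ˡ H₁ S₂ a b (⊆-∪ˡ G S₁ a b ab∈G))
      ... | inj₂ ab∈K with intraPart-adj {λ _ _ → true} {a} {b} ab∈K
      ...   | ab , _ , b≠a = same-part-⊆-H₃ ab b≠a
      rearrange : ∀ g k → g + (1 + k) ≡ g + k + 1
      rearrange = solve-∀

    ore-complete : ∀ a b → adj complete a b ≡ true → adj H₃ a b ≡ false → suc M ≤ deg H₃ a + deg H₃ b
    ore-complete a b a≠b _ = +-cancelʳ-≤ 2 _ _ (begin
      suc M + 2                              ≡⟨ cong (_+ 2) D+n≡N ⟨
      D + n + 2                              ≡⟨ rearrange D n ⟩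
      (D + 1) + n + 1                        ≤⟨ +-monoʳ-≤ ((D + 1) + n) 1≤n ⟩
      (D + 1) + n + n                        ≤⟨ +-monoˡ-≤ n (+-monoˡ-≤ n (pair-deg a≢b)) ⟩
      (deg G a + deg G b) + n + n            ≡⟨ rearrange′ (deg G a) (deg G b) n ⟩
      (deg G a + n) + (deg G b + n)          ≤⟨ +-mono-≤ (deg-H₃ a) (deg-H₃ b) ⟩
      (deg H₃ a + 1) + (deg H₃ b + 1)        ≡⟨ rearrange″ (deg H₃ a) (deg H₃ b) ⟩
      deg H₃ a + deg H₃ b + 2 ∎)
      where
      open ≤-Reasoning
      a≢b : a ≢ b
      a≢b refl = contradiction (trans (sym a≠b) (cong not (==-refl a))) λ ()
      rearrange : ∀ d m → d + m + 2 ≡ (d + 1) + m + 1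
      rearrange = solve-∀
      rearrange′ : ∀ g h m → (g + h) + m + m ≡ (g + m) + (h + m)
      rearrange′ = solve-∀
      rearrange″ : ∀ x y → (x + 1) + (y + 1) ≡ x + y + 2
      rearrange″ = solve-∀

    hamCycle : HamCycle G
    hamCycle =
      ( closure G  S₁       2≤M ore-S₁
      ∘ closure H₁ S₂       2≤M ore-S₂
      ∘ closure H₂ S₃       2≤M ore-S₃
      ∘ closure H₃ complete 2≤M ore-complete
      ) (hamCycle-mono (⊆-∪ʳ H₃ complete) (complete-hamCycle (≤-trans (s≤s z≤n) 2≤M)))

kC2+kC2≡k*[k∸1] : ∀ k → k C 2 + k C 2 ≡ k * (k ∸ 1)
kC2+kC2≡k*[k∸1] zero    = refl
kC2+kC2≡k*[k∸1] (suc k) = begin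
  suc k C 2 + suc k C 2       ≡⟨ cong₂ _+_ (pascal k) (pascal k) ⟨
  (k C 1 + k C 2) + (k C 1 + k C 2) ≡⟨ cong (λ c → (c + k C 2) + (c + k C 2)) (nC1≡n k) ⟩
  (k + k C 2) + (k + k C 2)   ≡⟨ rearrange k (k C 2) ⟩
  k + k + (k C 2 + k C 2)     ≡⟨ cong (k + k +_) (kC2+kC2≡k*[k∸1] k) ⟩
  k + k + k * (k ∸ 1)         ≡⟨ step k ⟩
  suc k * k ∎
  where
  open ≡-Reasoning
  pascal : ∀ k → k C 1 + k C 2 ≡ suc k C 2
  pascal k = nCk+nC[k+1]≡[n+1]C[k+1] k 1
  rearrange : ∀ a c → (a + c) + (a + c) ≡ a + a + (c + c)
  rearrange = solve-∀
  step : ∀ k → k + k + k * (k ∸ 1) ≡ suc k * k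
  step zero    = refl
  step (suc k) = identity k
    where
    identity : ∀ k → suc k + suc k + suc k * k ≡ suc (suc k) * suc k
    identity = solve-∀

n²kC2+n²kC2≡kn*[k∸1]n : ∀ k n → n ^ 2 * (k C 2) + n ^ 2 * (k C 2) ≡ (k * n) * ((k ∸ 1) * n)
n²kC2+n²kC2≡kn*[k∸1]n k n = begin
  n ^ 2 * (k C 2) + n ^ 2 * (k C 2)   ≡⟨ *-distribˡ-+ (n ^ 2) (k C 2) (k C 2) ⟨
  n ^ 2 * (k C 2 + k C 2)             ≡⟨ cong (n ^ 2 *_) (kC2+kC2≡k*[k∸1] k) ⟩
  n ^ 2 * (k * (k ∸ 1))               ≡⟨ regroup n k (k ∸ 1) ⟩
  (k * n) * ((k ∸ 1) * n) ∎
  where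
  open ≡-Reasoning
  regroup : ∀ n k l → n * (n * 1) * (k * l) ≡ (k * n) * (l * n)
  regroup = solve-∀

partSize≡count : ∀ {N k} (part : Fin N → Fin k) c → partSize part c ≡ count (λ w → part w == c)
partSize≡count {N} part c =
  trans (length-filter≡countᴸ (λ w → part w Finₚ.≟ c) (allFin N)) (countᴸ-tabulate (λ w → part w == c) (λ w → w))

balanced-order-≥3 : ∀ j m → ¬ (suc (suc j) ≡ 2 × suc m ≡ 1) → 3 ≤ suc (suc j) * suc m
balanced-order-≥3 zero    zero    not-K₂ = contradiction (refl , refl) not-K₂
balanced-order-≥3 zero    (suc m) _      = ≤-trans (s≤s (s≤s (s≤s z≤n))) (*-monoʳ-≤ 2 {2} {suc (suc m)} (s≤s (s≤s z≤n)))
balanced-order-≥3 (suc j) m       _      = *-mono-≤ {3} {suc (suc (suc j))} {1} {suc m} (s≤s (s≤s (s≤s z≤n))) (s≤s z≤n)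

theorem1 : (k n : ℕ) → k ≥ 2 → n ≥ 1 → ¬ (k ≡ 2 × n ≡ 1) →
    (G : SimpleGraph (k * n)) → (part : Fin (k * n) → Fin k) →
    IsBalancedMultipartite k n G part →
    n ^ 2 * (k C 2) + 2 ≤ edgeCount G + (k ∸ 1) * n →
    Hamiltonian G
theorem1 k@(suc (suc j)) n@(suc m) (s≤s (s≤s z≤n)) (s≤s z≤n) not-K₂ G part (sizes , independent) dense =
  hamCycle⇒hamiltonian 2≤M (Dense.hamCycle (edges⇒few-missing (n ^ 2 * (k C 2)) (n²kC2+n²kC2≡kn*[k∸1]n k n) dense))
  where
  D : ℕ
  D = (k ∸ 1) * n
  -- k * n reduces to suc (m + suc j * suc m) for these patterns
  2≤M : 2 ≤ m + suc j * suc m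
  2≤M = s≤s⁻¹ (balanced-order-≥3 j m not-K₂)
  part-size : ∀ v → count (λ w → part v == part w) ≡ n
  part-size v = trans (count-cong (λ w → ==-sym (part v) (part w))) (trans (sym (partSize≡count part (part v))) (sizes (part v)))
  open BalancedMultipartite G part n D part-size independent (+-comm D n) (m≤m+n n (j * n)) (s≤s z≤n) 2≤M
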